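{- Let $q,n$ be positive integers and let $h:\mathcal{A}_q(n)\to\mathbb{C}$ be a function whose value depends only on the first $q$ entries of its input. Then \[ \sum_{t\in\mathcal{A}_q(n)}h(t)=q!\sum_{\pi\in\Pi_q}\;\sum_{\substack{u\in(\mathbb{Z}/n\mathbb{Z})^q\\ u\prec\pi}}h(u|u)\prod_{B\in\pi}\frac{C(|B|)}{|B|!}, \] where $u|u$ is the $2q$-tuple whose first and second halves both equal $u$.
   Context: A tuple $(t_1,\dots,t_{2q})$ is an abelian square if there is a permutation $\sigma$ of $\{1,\dots,q\}$ with $t_{\sigma(k)}=t_{q+k}$ for all $k$; $\mathcal{A}_q(n)$ is the set of abelian squares in $(\mathbb{Z}/n\mathbb{Z})^{2q}$. $\Pi_q$ is the set of set partitions of $\{1,\dots,q\}$ (elements called blocks). For $u\in(\mathbb{Z}/n\mathbb{Z})^q$ and $\pi\in\Pi_q$, $u\prec\pi$ means $u_j=u_k$ whenever $j,k$ lie in the same block of $\pi$. The signed Carlitz numbers $C(k)$ are defined by $\log(J_0(2\sqrt{z}))=\sum_{k\ge1}\frac{(-1)^kC(k)}{(k!)^2}z^k$, where $J_0$ is the zeroth Bessel function of the first kind. -}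

module Defs where

open import Level using (Level)
open import Data.Bool using (Bool; true; false; T; if_then_else_)
open import Data.Nat as ℕ using (ℕ; zero; suc; _!; _<_)
import Data.Nat.Properties
open Data.Nat.Properties using (_!≢0)
open import Data.Fin using (Fin; toℕ; _↑ˡ_; _↑ʳ_)
open import Data.Fin.Properties using (all?)
open import Data.Fin.Permutation using (Permutation′; _⟨$⟩ʳ_)
open import Data.Integer as ℤ using (ℤ)
open import Data.Rational as ℚ using (ℚ; 0ℚ; 1ℚ)
open import Data.List as List using (List; []; _∷_; filter; allFin; concatMap; map; foldr; length)
open import Data.Vec as Vec using (Vec; lookup; _++_)
open import Data.Product using (Σ; ∃; _,_)
open import Relation.Nullary using (Dec; ¬_)
open import Relation.Nullary.Decidable using (_→-dec_; ¬?)
open import Relation.Binary.PropositionalEquality using (_≡_)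
open import Data.Fin using (_≟_)
open import Algebra.Bundles using (CommutativeRing)

-- Abelian squares in (ℤ/nℤ)^{2q}; ℤ/nℤ is represented by Fin n and a
-- 2q-tuple by a vector of length q + q.

fstHalf : ∀ {n} q → Vec (Fin n) (q ℕ.+ q) → Fin q → Fin n
fstHalf q t k = lookup t (k ↑ˡ q)

sndHalf : ∀ {n} q → Vec (Fin n) (q ℕ.+ q) → Fin q → Fin n
sndHalf q t k = lookup t (q ↑ʳ k)

IsAbelianSquare : ∀ {n} q → Vec (Fin n) (q ℕ.+ q) → Set
IsAbelianSquare q t =
  Σ (Permutation′ q) λ σ → ∀ k → fstHalf q t (σ ⟨$⟩ʳ k) ≡ sndHalf q t k

double : ∀ {n q} → Vec (Fin n) q → Vec (Fin n) (q ℕ.+ q)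
double u = u ++ u

allVecs : ∀ {a} {A : Set a} → List A → (k : ℕ) → List (Vec A k)
allVecs xs zero    = Vec.[] ∷ []
allVecs xs (suc k) = concatMap (λ x → map (x Vec.∷_) (allVecs xs k)) xs

-- Set partitions of {1..q}, represented (as usual) by the equivalence
-- relation "lie in the same block", given as a q×q Boolean matrix.

Relation : ℕ → Set
Relation q = Vec (Vec Bool q) q

rel : ∀ {q} → Relation q → Fin q → Fin q → Bool
rel r i j = lookup (lookup r i) j

IsEquivalenceRel : ∀ {q} → Relation q → Set
IsEquivalenceRel {q} r =
  (∀ i → T (rel r i i)) Data.Product.×
  ((∀ i j → T (rel r i j) → T (rel r j i)) Data.Product.×
   (∀ i j k → T (rel r i j) → T (rel r j k) → T (rel r i k)))

T? : ∀ b → Dec (T b)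
T? = Data.Bool.T?

isEquivalenceRel? : ∀ {q} (r : Relation q) → Dec (IsEquivalenceRel r)
isEquivalenceRel? r =
  Relation.Nullary.Decidable._×-dec_
    (all? λ i → T? (rel r i i))
    (Relation.Nullary.Decidable._×-dec_
      (all? λ i → all? λ j → T? (rel r i j) →-dec T? (rel r j i))
      (all? λ i → all? λ j → all? λ k →
         T? (rel r i j) →-dec (T? (rel r j k) →-dec T? (rel r i k))))

SetPartitions : (q : ℕ) → List (Relation q)
SetPartitions q = filter isEquivalenceRel? (allVecs (allVecs (true ∷ false ∷ []) q) q)

_≺_ : ∀ {n q} → Vec (Fin n) q → Relation q → Set
u ≺ π = ∀ i j → T (rel π i j) → lookup u i ≡ lookup u j

_≺?_ : ∀ {n q} (u : Vec (Fin n) q) (π : Relation q) → Dec (u ≺ π)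
u ≺? π = all? λ i → all? λ j → T? (rel π i j) →-dec (lookup u i ≟ lookup u j)

-- the blocks of π, each listed once through its least element
IsLeastInBlock : ∀ {q} → Relation q → Fin q → Set
IsLeastInBlock π i = ∀ j → toℕ j < toℕ i → ¬ T (rel π j i)

isLeastInBlock? : ∀ {q} (π : Relation q) (i : Fin q) → Dec (IsLeastInBlock π i)
isLeastInBlock? π i = all? λ j → (toℕ j ℕ.<? toℕ i) →-dec ¬? (T? (rel π j i))

blockReps : ∀ {q} → Relation q → List (Fin q)
blockReps {q} π = filter (isLeastInBlock? π) (allFin q)

blockSize : ∀ {q} → Relation q → Fin q → ℕ
blockSize {q} π i = length (filter (λ j → T? (rel π i j)) (allFin q))

-- Signed Carlitz numbers:  log(J₀(2√z)) = Σ_{k≥1} (-1)^k C(k) z^k / (k!)²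
-- Formal power series over ℚ are coefficient functions ℕ → ℚ.

Series : Set
Series = ℕ → ℚ

sumUpTo : ℕ → (ℕ → ℚ) → ℚ
sumUpTo zero    f = f 0
sumUpTo (suc k) f = sumUpTo k f ℚ.+ f (suc k)

_⊛_ : Series → Series → Series
(f ⊛ g) k = sumUpTo k λ i → f i ℚ.* g (k ℕ.∸ i)

_^ₛ_ : Series → ℕ → Series
f ^ₛ zero  = λ { zero → 1ℚ ; (suc _) → 0ℚ }
f ^ₛ suc m = f ⊛ (f ^ₛ m)

sign : ℕ → ℤ
sign zero    = ℤ.+ 1
sign (suc k) = ℤ.- sign k

J₀2√ : Series
J₀2√ k = (sign k ℚ./ (k ! ℕ.* k !)) {{Data.Nat.Properties.m*n≢0 (k !) (k !) {{k !≢0}} {{k !≢0}}}}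

gSeries : Series
gSeries zero    = 0ℚ
gSeries (suc k) = J₀2√ (suc k)

-- log(1 + g) = Σ_{m≥1} (-1)^{m+1} g^m / m ; the z^k coefficient only
-- involves m ≤ k since g has zero constant term.
logJ₀2√ : Series
logJ₀2√ zero    = 0ℚ
logJ₀2√ (suc k) = sumUpTo k λ i →
  (sign i ℚ./ suc i) ℚ.* (gSeries ^ₛ suc i) (suc k)

Carlitz : ℕ → ℚ
Carlitz k = (sign k ℚ./ 1) ℚ.* ((ℤ.+ (k ! ℕ.* k !)) ℚ./ 1) ℚ.* logJ₀2√ k

_!ℚ : ℕ → ℚ
k !ℚ = (ℤ.+ (k !)) ℚ./ 1

carlitzOverFact : ℕ → ℚ
carlitzOverFact s = Carlitz s ℚ.* (ℚ._/_ (ℤ.+ 1) (s !) {{s !≢0}})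

weight : ∀ {q} → Relation q → ℚ
weight {q} π =
  q !ℚ ℚ.* foldr (λ i acc → carlitzOverFact (blockSize π i) ℚ.* acc) 1ℚ (blockReps π)

module _ {c ℓ} (R : CommutativeRing c ℓ) where
  open CommutativeRing R

  sumR : ∀ {a} {A : Set a} → List A → (A → Carrier) → Carrier
  sumR xs f = foldr (λ x acc → f x + acc) 0# xs

{-# OPTIONS --safe #-}
-- Group the abelian squares by their first half u: those with first half u are the u|v with v a
-- rearrangement of u, so the left-hand side is Σ_u h(u|u) · q!/∏_a m_a!, where m_a counts the
-- occurrences of a in u. On the right, exchanging the sums leaves Σ_{π : u ≺ π} q! ∏_B C(|B|)/|B|!,
-- and the partitions π with u ≺ π are the products of partitions of the fibres of u, so it is
-- enough that Σ_{π ∈ Π_m} ∏_B C(|B|)/|B|! = 1/m!. Splitting off the block of the least element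
-- reduces this to Σ_j binom(m-1, j) binom(m, j+1) C(j+1) = 1, the coefficient of z^m in
-- z (log J)′ J = z J′ for J(z) = J₀(2√z) = Σ_k (-1)^k z^k/(k!)².
module Submission where

module Prelude where

  open import Data.Bool using (true; false; T)
  open import Data.Empty using (⊥; ⊥-elim)
  open import Data.List using (List; []; _∷_; map)
  open import Data.List.Membership.Propositional using (_∈_)
  open import Data.List.Membership.Propositional.Properties using (∈-map⁻)
  open import Data.List.Membership.Propositional.Properties.WithK using (unique∧set⇒bag)
  open import Data.List.Relation.Binary.BagAndSetEquality using (∼bag⇒↭)
  open import Data.List.Relation.Binary.Permutation.Propositional using (_↭_)
  open import Data.List.Relation.Unary.All as All using ()
  open import Data.List.Relation.Unary.AllPairs using ([]; _∷_)
  open import Data.List.Relation.Unary.Any using (here; there)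
  open import Data.List.Relation.Unary.Unique.Propositional using (Unique)
  open import Data.Product using (_,_)
  open import Data.Unit using (tt)
  open import Data.Vec using (Vec; lookup)
  import Data.Vec.Properties as Vec
  open import Function.Bundles using (mk⇔)
  open import Relation.Binary.PropositionalEquality
  open import Relation.Nullary using (Dec; yes; no; does; ¬_)

  ↭-fromUnique : ∀ {a} {A : Set a} {xs ys : List A} → Unique xs → Unique ys →
                 (∀ {z} → z ∈ xs → z ∈ ys) → (∀ {z} → z ∈ ys → z ∈ xs) → xs ↭ ys
  ↭-fromUnique ux uy to from = ∼bag⇒↭ (unique∧set⇒bag ux uy (mk⇔ to from))

  unique-map⁺-on : ∀ {a b} {A : Set a} {B : Set b} (g : A → B) (xs : List A) → Unique xs →
    (∀ {x y} → x ∈ xs → y ∈ xs → g x ≡ g y → x ≡ y) → Unique (map g xs)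
  unique-map⁺-on g []       _          _   = []
  unique-map⁺-on g (x ∷ xs) (x∉ ∷ uxs) inj =
    All.tabulate (λ {z} z∈ gx≡z → distinct z z∈ gx≡z) ∷ unique-map⁺-on g xs uxs (λ x∈ y∈ → inj (there x∈) (there y∈))
    where
    distinct : ∀ z → z ∈ map g xs → g x ≡ z → ⊥
    distinct z z∈ gx≡z with ∈-map⁻ g z∈
    ... | y , y∈ , refl = All.lookup x∉ y∈ (inj (here refl) (there y∈) gx≡z)

  vec-ext : ∀ {a} {A : Set a} {q} (v w : Vec A q) → (∀ i → lookup v i ≡ lookup w i) → v ≡ w
  vec-ext v w v≗w = trans (sym (Vec.tabulate∘lookup v)) (trans (Vec.tabulate-cong v≗w) (Vec.tabulate∘lookup w))

  ¬T⇒≡false : ∀ {b} → ¬ T b → b ≡ false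
  ¬T⇒≡false {false} _  = refl
  ¬T⇒≡false {true}  ¬t = ⊥-elim (¬t tt)

  does-cong : ∀ {a b} {P : Set a} {Q : Set b} (P? : Dec P) (Q? : Dec Q) → (P → Q) → (Q → P) → does P? ≡ does Q?
  does-cong (yes p) (yes q) _ _ = refl
  does-cong (no ¬p) (no ¬q) _ _ = refl
  does-cong (yes p) (no ¬q) f _ = ⊥-elim (¬q (f p))
  does-cong (no ¬p) (yes q) _ g = ⊥-elim (¬p (g q))

  does-reflects : ∀ {p} {P : Set p} (P? : Dec P) b → (P → T b) → (T b → P) → does P? ≡ b
  does-reflects (yes p) true  _ _ = refl
  does-reflects (yes p) false f _ = ⊥-elim (f p)
  does-reflects (no ¬p) true  _ g = ⊥-elim (¬p (g tt))
  does-reflects (no ¬p) false _ _ = refl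

module ListSum where

  open import Algebra.Bundles using (CommutativeRing)
  import Algebra.Properties.CommutativeSemigroup as CommutativeSemigroupProperties
  open import Data.Bool using (true; false; if_then_else_)
  open import Data.List using (List; []; _∷_; _++_; map; filter; concatMap)
  open import Data.List.Membership.Propositional using (_∈_; _∉_)
  import Data.List.Relation.Binary.Permutation.Propositional as ↭
  open ↭ using (_↭_)
  open import Data.List.Relation.Unary.All as All using ()
  open import Data.List.Relation.Unary.Any using (here; there)
  open import Data.List.Relation.Unary.AllPairs using (_∷_)
  open import Data.List.Relation.Unary.Unique.Propositional using (Unique)
  open import Data.Empty using (⊥-elim)
  open import Function using (_∘_)
  open import Relation.Binary.PropositionalEquality as ≡ using (_≡_)
  open import Relation.Nullary using (Dec; yes; no; does)
  open import Relation.Unary using (Pred; Decidable)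

  open import Defs using (sumR)

  module _ {c ℓ} (R : CommutativeRing c ℓ) where
    open CommutativeRing R
    open CommutativeSemigroupProperties +-commutativeSemigroup using (interchange; x∙yz≈y∙xz)

    ∑ : ∀ {a} {A : Set a} → List A → (A → Carrier) → Carrier
    ∑ = sumR R

    module _ {a} {A : Set a} where

      sum-cong : ∀ (xs : List A) {f g : A → Carrier} → (∀ x → f x ≈ g x) → ∑ xs f ≈ ∑ xs g
      sum-cong []       f≈g = refl
      sum-cong (x ∷ xs) f≈g = +-cong (f≈g x) (sum-cong xs f≈g)

      sum-cong-∈ : ∀ (xs : List A) {f g : A → Carrier} → (∀ {x} → x ∈ xs → f x ≈ g x) → ∑ xs f ≈ ∑ xs g
      sum-cong-∈ []       f≈g = refl
      sum-cong-∈ (x ∷ xs) f≈g = +-cong (f≈g (here ≡.refl)) (sum-cong-∈ xs (f≈g ∘ there))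

      sum-++ : ∀ (xs ys : List A) (f : A → Carrier) → ∑ (xs ++ ys) f ≈ ∑ xs f + ∑ ys f
      sum-++ []       ys f = sym (+-identityˡ _)
      sum-++ (x ∷ xs) ys f = trans (+-congˡ (sum-++ xs ys f)) (sym (+-assoc _ _ _))

      sum-0 : ∀ (xs : List A) → ∑ xs (λ _ → 0#) ≈ 0#
      sum-0 []       = refl
      sum-0 (x ∷ xs) = trans (+-identityˡ _) (sum-0 xs)

      sum-+ : ∀ (xs : List A) (f g : A → Carrier) → ∑ xs (λ x → f x + g x) ≈ ∑ xs f + ∑ xs g
      sum-+ []       f g = sym (+-identityˡ _)
      sum-+ (x ∷ xs) f g = trans (+-congˡ (sum-+ xs f g)) (interchange _ _ _ _)

      sum-*ˡ : ∀ (xs : List A) (k : Carrier) (f : A → Carrier) → k * ∑ xs f ≈ ∑ xs (λ x → k * f x)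
      sum-*ˡ []       k f = zeroʳ k
      sum-*ˡ (x ∷ xs) k f = trans (distribˡ k _ _) (+-congˡ (sum-*ˡ xs k f))

      sum-*ʳ : ∀ (xs : List A) (k : Carrier) (f : A → Carrier) → ∑ xs f * k ≈ ∑ xs (λ x → f x * k)
      sum-*ʳ xs k f = trans (*-comm _ _) (trans (sum-*ˡ xs k f) (sum-cong xs (λ x → *-comm _ _)))

      sum-↭ : ∀ {xs ys : List A} (f : A → Carrier) → xs ↭ ys → ∑ xs f ≈ ∑ ys f
      sum-↭ f ↭.refl          = refl
      sum-↭ f (↭.prep x p)    = +-congˡ (sum-↭ f p)
      sum-↭ f (↭.swap x y p)  = trans (x∙yz≈y∙xz _ _ _) (+-congˡ (+-congˡ (sum-↭ f p)))
      sum-↭ f (↭.trans p q)   = trans (sum-↭ f p) (sum-↭ f q)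

      sum-filter : ∀ {p} {P : Pred A p} (P? : Decidable P) (xs : List A) (f : A → Carrier) →
                   ∑ (filter P? xs) f ≈ ∑ xs (λ x → if does (P? x) then f x else 0#)
      sum-filter P? []       f = refl
      sum-filter P? (x ∷ xs) f with does (P? x)
      ... | true  = +-congˡ (sum-filter P? xs f)
      ... | false = trans (sum-filter P? xs f) (sym (+-identityˡ _))

    module _ {a b} {A : Set a} {B : Set b} where

      sum-map : ∀ (xs : List A) (g : A → B) (f : B → Carrier) → ∑ (map g xs) f ≈ ∑ xs (f ∘ g)
      sum-map []       g f = refl
      sum-map (x ∷ xs) g f = +-congˡ (sum-map xs g f)

      sum-swap : ∀ (xs : List A) (ys : List B) (f : A → B → Carrier) →
                 ∑ xs (λ x → ∑ ys (f x)) ≈ ∑ ys (λ y → ∑ xs (λ x → f x y))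
      sum-swap []       ys f = sym (sum-0 ys)
      sum-swap (x ∷ xs) ys f = trans (+-congˡ (sum-swap xs ys f)) (sym (sum-+ ys (f x) _))

      sum-concatMap : ∀ (xs : List A) (g : A → List B) (f : B → Carrier) →
                      ∑ (concatMap g xs) f ≈ ∑ xs (λ x → ∑ (g x) f)
      sum-concatMap []       g f = refl
      sum-concatMap (x ∷ xs) g f = trans (sum-++ (g x) _ f) (+-congˡ (sum-concatMap xs g f))

    module _ {a} {A : Set a} (_≟_ : (x y : A) → Dec (x ≡ y)) where

      δ : A → Carrier → A → Carrier
      δ x c y = if does (x ≟ y) then c else 0#

      sum-δ-∉ : ∀ (xs : List A) {x : A} (c : Carrier) → x ∉ xs → ∑ xs (δ x c) ≈ 0#
      sum-δ-∉ []       c x∉ = refl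
      sum-δ-∉ (y ∷ xs) {x} c x∉ with x ≟ y
      ... | yes ≡.refl = ⊥-elim (x∉ (here ≡.refl))
      ... | no _     = trans (+-identityˡ _) (sum-δ-∉ xs c (x∉ ∘ there))

      sum-δ : ∀ (xs : List A) {x : A} (c : Carrier) → Unique xs → x ∈ xs → ∑ xs (δ x c) ≈ c
      sum-δ (y ∷ xs) {x} c (y∉ ∷ u) x∈ with x ≟ y
      sum-δ (y ∷ xs) c (y∉ ∷ u) x∈        | yes ≡.refl =
        trans (+-congˡ (sum-δ-∉ xs c (λ m → All.lookup y∉ m ≡.refl))) (+-identityʳ _)
      sum-δ (y ∷ xs) c (y∉ ∷ u) (here e)  | no x≢y = ⊥-elim (x≢y e)
      sum-δ (y ∷ xs) c (y∉ ∷ u) (there m) | no _   = trans (+-identityˡ _) (sum-δ xs c u m)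

module Fractions where

  open import Data.Nat as ℕ using (ℕ; suc; NonZero)
  import Data.Nat.Properties as ℕ
  open import Data.Integer as ℤ using (ℤ; +_)
  import Data.Integer.Properties as ℤ
  open import Data.Rational as ℚ using (ℚ; _/_; 1ℚ)
  import Data.Rational.Properties as ℚ
  open import Data.Rational.Unnormalised as ℚᵘ using (mkℚᵘ; *≡*)
  import Data.Rational.Unnormalised.Properties as ℚᵘ
  open import Relation.Binary.PropositionalEquality

  private
    toℚᵘ-/ : ∀ a m → ℚ.toℚᵘ (a / suc m) ℚᵘ.≃ mkℚᵘ a m
    toℚᵘ-/ a m = ℚ.toℚᵘ-fromℚᵘ (mkℚᵘ a m)

  /-*-/ : ∀ a b m n .{{_ : NonZero m}} .{{_ : NonZero n}} →
          (a / m) ℚ.* (b / n) ≡ ((a ℤ.* b) / (m ℕ.* n)) {{ℕ.m*n≢0 m n}}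
  /-*-/ a b (suc m) (suc n) = ℚ.toℚᵘ-injective (ℚᵘ.≃-trans (ℚ.toℚᵘ-homo-* (a / suc m) (b / suc n))
    (ℚᵘ.≃-trans (ℚᵘ.*-cong (toℚᵘ-/ a m) (toℚᵘ-/ b n)) (ℚᵘ.≃-sym (toℚᵘ-/ (a ℤ.* b) _))))

  /-+-/ : ∀ a b m n → (a / suc m) ℚ.+ (b / suc n) ≡ (a ℤ.* + suc n ℤ.+ b ℤ.* + suc m) / (suc m ℕ.* suc n)
  /-+-/ a b m n = ℚ.toℚᵘ-injective (ℚᵘ.≃-trans (ℚ.toℚᵘ-homo-+ (a / suc m) (b / suc n))
    (ℚᵘ.≃-trans (ℚᵘ.+-cong (toℚᵘ-/ a m) (toℚᵘ-/ b n)) (ℚᵘ.≃-sym (toℚᵘ-/ _ _))))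

  neg-/ : ∀ a m → (ℤ.- a) / suc m ≡ ℚ.- (a / suc m)
  neg-/ a m = ℚ.toℚᵘ-injective (ℚᵘ.≃-trans (toℚᵘ-/ (ℤ.- a) m)
    (ℚᵘ.≃-sym (ℚᵘ.≃-trans (ℚ.toℚᵘ-homo‿- (a / suc m)) (ℚᵘ.-‿cong (toℚᵘ-/ a m)))))

  /-cross : ∀ a b m n .{{_ : NonZero m}} .{{_ : NonZero n}} → a ℤ.* + n ≡ b ℤ.* + m → a / m ≡ b / n
  /-cross a b (suc m) (suc n) e = ℚ.fromℚᵘ-cong {mkℚᵘ a m} {mkℚᵘ b n} (*≡* e)

  fromℕ : ℕ → ℚ
  fromℕ n = + n / 1

  fromℕ-+ : ∀ a b → fromℕ (a ℕ.+ b) ≡ fromℕ a ℚ.+ fromℕ b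
  fromℕ-+ a b = sym (trans (/-+-/ (+ a) (+ b) 0 0) (cong (_/ 1) (cong₂ ℤ._+_ (ℤ.*-identityʳ (+ a)) (ℤ.*-identityʳ (+ b)))))

  fromℕ-* : ∀ a b → fromℕ (a ℕ.* b) ≡ fromℕ a ℚ.* fromℕ b
  fromℕ-* a b = trans (cong (_/ 1) (ℤ.pos-* a b)) (sym (/-*-/ (+ a) (+ b) 1 1))

  fromℕ-suc : ∀ n → fromℕ (suc n) ≡ 1ℚ ℚ.+ fromℕ n
  fromℕ-suc = fromℕ-+ 1

  1/n*n≡1 : ∀ n .{{_ : NonZero n}} → ((+ 1) / n) ℚ.* fromℕ n ≡ 1ℚ
  1/n*n≡1 n = trans (/-*-/ (+ 1) (+ n) n 1)
    (/-cross (+ 1 ℤ.* + n) (+ 1) (n ℕ.* 1) 1 {{ℕ.m*n≢0 n 1}}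
      (trans (ℤ.*-identityʳ _) (trans (ℤ.*-identityˡ (+ n))
        (sym (trans (ℤ.*-identityˡ (+ (n ℕ.* 1))) (cong +_ (ℕ.*-identityʳ n)))))))

module RangeSum where

  open import Data.Nat as ℕ using (ℕ; zero; suc; _≤_; _<_; _∸_; s≤s)
  import Data.Nat.Properties as ℕ
  open import Data.Rational as ℚ using (ℚ; 0ℚ; _+_; _*_)
  import Data.Rational.Properties as ℚ
  open import Relation.Binary.PropositionalEquality
  open import Algebra.Bundles using (CommutativeMonoid)
  open import Algebra.Properties.CommutativeSemigroup (CommutativeMonoid.commutativeSemigroup ℚ.+-0-commutativeMonoid)
    using (interchange)
  open ≡-Reasoning

  open import Defs using (sumUpTo)

  ∑< : ℕ → (ℕ → ℚ) → ℚ
  ∑< zero    f = 0ℚ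
  ∑< (suc n) f = ∑< n f + f n

  sumUpTo≡∑< : ∀ k f → sumUpTo k f ≡ ∑< (suc k) f
  sumUpTo≡∑< zero    f = sym (ℚ.+-identityˡ (f 0))
  sumUpTo≡∑< (suc k) f = cong (_+ f (suc k)) (sumUpTo≡∑< k f)

  ∑<-cong : ∀ n {f g : ℕ → ℚ} → (∀ i → i < n → f i ≡ g i) → ∑< n f ≡ ∑< n g
  ∑<-cong zero    f≡g = refl
  ∑<-cong (suc n) f≡g = cong₂ _+_ (∑<-cong n (λ i i<n → f≡g i (ℕ.m<n⇒m<1+n i<n))) (f≡g n (ℕ.n<1+n n))

  ∑<-zero : ∀ n f → (∀ i → i < n → f i ≡ 0ℚ) → ∑< n f ≡ 0ℚ
  ∑<-zero zero    f f≡0 = refl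
  ∑<-zero (suc n) f f≡0 = trans (cong₂ _+_ (∑<-zero n f (λ i i<n → f≡0 i (ℕ.m<n⇒m<1+n i<n))) (f≡0 n (ℕ.n<1+n n)))
                                 (ℚ.+-identityˡ 0ℚ)

  ∑<-+ : ∀ n f g → ∑< n (λ i → f i + g i) ≡ ∑< n f + ∑< n g
  ∑<-+ zero    f g = sym (ℚ.+-identityˡ 0ℚ)
  ∑<-+ (suc n) f g = trans (cong (_+ (f n + g n)) (∑<-+ n f g)) (interchange (∑< n f) (∑< n g) (f n) (g n))

  ∑<-*ˡ : ∀ n c f → c * ∑< n f ≡ ∑< n (λ i → c * f i)
  ∑<-*ˡ zero    c f = ℚ.*-zeroʳ c
  ∑<-*ˡ (suc n) c f = trans (ℚ.*-distribˡ-+ c _ _) (cong (_+ (c * f n)) (∑<-*ˡ n c f))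

  ∑<-*ʳ : ∀ n c f → ∑< n f * c ≡ ∑< n (λ i → f i * c)
  ∑<-*ʳ n c f = trans (ℚ.*-comm _ c) (trans (∑<-*ˡ n c f) (∑<-cong n (λ i _ → ℚ.*-comm c (f i))))

  ∑<-shift : ∀ n f → ∑< (suc n) f ≡ f 0 + ∑< n (λ i → f (suc i))
  ∑<-shift zero    f = trans (ℚ.+-identityˡ (f 0)) (sym (ℚ.+-identityʳ (f 0)))
  ∑<-shift (suc n) f = trans (cong (_+ f (suc n)) (∑<-shift n f)) (ℚ.+-assoc (f 0) _ (f (suc n)))

  ∑<-reverse : ∀ n f → ∑< n f ≡ ∑< n (λ i → f (n ∸ suc i))
  ∑<-reverse zero    f = refl
  ∑<-reverse (suc n) f = begin
    ∑< n f + f n                     ≡⟨ cong (_+ f n) (∑<-reverse n f) ⟩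
    ∑< n (λ i → f (n ∸ suc i)) + f n ≡⟨ ℚ.+-comm _ (f n) ⟩
    f n + ∑< n (λ i → f (n ∸ suc i)) ≡⟨ sym (∑<-shift n (λ i → f (n ∸ i))) ⟩
    ∑< (suc n) (λ i → f (n ∸ i))     ∎

  ∑<-comm : ∀ n m (F : ℕ → ℕ → ℚ) → ∑< n (λ i → ∑< m (F i)) ≡ ∑< m (λ j → ∑< n (λ i → F i j))
  ∑<-comm zero    m F = sym (∑<-zero m _ (λ _ _ → refl))
  ∑<-comm (suc n) m F = trans (cong (_+ ∑< m (F n)) (∑<-comm n m F)) (sym (∑<-+ m _ (F n)))

  ∑<-triangle : ∀ n (F : ℕ → ℕ → ℚ) →
    ∑< n (λ j → ∑< (suc j) (λ i → F i j)) ≡ ∑< n (λ i → ∑< (n ∸ i) (λ a → F i (i ℕ.+ a)))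
  ∑<-triangle zero    F = refl
  ∑<-triangle (suc n) F = begin
    ∑< n (λ j → ∑< (suc j) (λ i → F i j)) + ∑< (suc n) (λ i → F i n)
      ≡⟨ cong (_+ ∑< (suc n) (λ i → F i n)) (∑<-triangle n F) ⟩
    ∑< n row + ∑< (suc n) (λ i → F i n)
      ≡⟨ cong (λ z → z + ∑< (suc n) (λ i → F i n)) (sym (trans (cong (∑< n row +_) emptyRow) (ℚ.+-identityʳ (∑< n row)))) ⟩
    ∑< (suc n) row + ∑< (suc n) (λ i → F i n)
      ≡⟨ sym (∑<-+ (suc n) row (λ i → F i n)) ⟩
    ∑< (suc n) (λ i → row i + F i n)
      ≡⟨ ∑<-cong (suc n) extendRow ⟩
    ∑< (suc n) (λ i → ∑< (suc n ∸ i) (λ a → F i (i ℕ.+ a))) ∎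
    where
    row : ℕ → ℚ
    row i = ∑< (n ∸ i) (λ a → F i (i ℕ.+ a))
    emptyRow : row n ≡ 0ℚ
    emptyRow = cong (λ z → ∑< z (λ a → F n (n ℕ.+ a))) (ℕ.n∸n≡0 n)
    extendRow : ∀ i → i < suc n → row i + F i n ≡ ∑< (suc n ∸ i) (λ a → F i (i ℕ.+ a))
    extendRow i (s≤s i≤n) = begin
      row i + F i n                           ≡⟨ cong (λ z → row i + F i z) (sym (ℕ.m+[n∸m]≡n i≤n)) ⟩
      ∑< (suc (n ∸ i)) (λ a → F i (i ℕ.+ a)) ≡⟨ cong (λ z → ∑< z (λ a → F i (i ℕ.+ a))) (sym (ℕ.+-∸-assoc 1 i≤n)) ⟩
      ∑< (suc n ∸ i) (λ a → F i (i ℕ.+ a))   ∎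

  ∑<-+-vanishing : ∀ n k f → (∀ i → n ≤ i → f i ≡ 0ℚ) → ∑< (n ℕ.+ k) f ≡ ∑< n f
  ∑<-+-vanishing n zero    f f≡0 = cong (λ z → ∑< z f) (ℕ.+-identityʳ n)
  ∑<-+-vanishing n (suc k) f f≡0 = begin
    ∑< (n ℕ.+ suc k) f             ≡⟨ cong (λ z → ∑< z f) (ℕ.+-suc n k) ⟩
    ∑< (n ℕ.+ k) f + f (n ℕ.+ k)   ≡⟨ cong₂ _+_ (∑<-+-vanishing n k f f≡0) (f≡0 _ (ℕ.m≤m+n n k)) ⟩
    ∑< n f + 0ℚ                    ≡⟨ ℚ.+-identityʳ (∑< n f) ⟩
    ∑< n f                         ∎

  ∑<-vanishing : ∀ n m f → n ≤ m → (∀ i → n ≤ i → f i ≡ 0ℚ) → ∑< m f ≡ ∑< n f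
  ∑<-vanishing n m f n≤m f≡0 =
    trans (cong (λ z → ∑< z f) (sym (ℕ.m+[n∸m]≡n n≤m))) (∑<-+-vanishing n (m ∸ n) f f≡0)

module Binomial where

  open import Data.Nat using (suc; _*_; _∸_; _≤_; _!; s≤s)
  open import Data.Nat.Properties
  open import Data.Nat.Combinatorics using (_C_; nCk≡n!/k![n-k]!; k![n∸k]!∣n!; k>n⇒nCk≡0)
  open import Data.Nat.DivMod using (m/n*n≡m)
  open import Data.Nat.Solver using (module +-*-Solver)
  open +-*-Solver using (solve; _:*_; _:=_)
  open import Relation.Binary.PropositionalEquality
  open import Relation.Nullary using (yes; no)
  open ≡-Reasoning

  nCk*k!*[n∸k]!≡n! : ∀ {n k} → k ≤ n → (n C k) * (k ! * (n ∸ k) !) ≡ n !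
  nCk*k!*[n∸k]!≡n! {n} {k} k≤n = trans (cong (_* (k ! * (n ∸ k) !)) (nCk≡n!/k![n-k]! k≤n))
                                       (m/n*n≡m {{_}} (k![n∸k]!∣n! k≤n))

  [k+1]*[n+1]C[k+1]≡[n+1]*nCk : ∀ n k → suc k * (suc n C suc k) ≡ suc n * (n C k)
  [k+1]*[n+1]C[k+1]≡[n+1]*nCk n k with k ≤? n
  ... | yes k≤n = *-cancelʳ-≡ _ _ (k ! * (n ∸ k) !) {{m*n≢0 (k !) ((n ∸ k) !) {{k !≢0}} {{(n ∸ k) !≢0}}}} (begin
    suc k * (suc n C suc k) * (k ! * (n ∸ k) !)
      ≡⟨ solve 4 (λ s b f g → s :* b :* (f :* g) := b :* ((s :* f) :* g)) refl (suc k) (suc n C suc k) (k !) ((n ∸ k) !) ⟩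
    (suc n C suc k) * (suc k ! * (suc n ∸ suc k) !) ≡⟨ nCk*k!*[n∸k]!≡n! (s≤s k≤n) ⟩
    suc n * n !                                    ≡⟨ cong (suc n *_) (sym (nCk*k!*[n∸k]!≡n! k≤n)) ⟩
    suc n * ((n C k) * (k ! * (n ∸ k) !))           ≡⟨ sym (*-assoc (suc n) (n C k) _) ⟩
    suc n * (n C k) * (k ! * (n ∸ k) !)           ∎)
  ... | no k≰n = begin
    suc k * (suc n C suc k) ≡⟨ cong (suc k *_) (k>n⇒nCk≡0 (s≤s (≰⇒> k≰n))) ⟩
    suc k * 0               ≡⟨ *-zeroʳ (suc k) ⟩
    0                       ≡⟨ sym (*-zeroʳ (suc n)) ⟩
    suc n * 0               ≡⟨ cong (suc n *_) (sym (k>n⇒nCk≡0 (≰⇒> k≰n))) ⟩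
    suc n * (n C k)         ∎

module PowerSeries where

  open import Data.Nat as ℕ using (ℕ; zero; suc; _≤_; _<_; _∸_; s≤s)
  import Data.Nat.Properties as ℕ
  open import Data.Rational as ℚ using (ℚ; 0ℚ; 1ℚ; _+_; _*_)
  import Data.Rational.Properties as ℚ
  open import Data.Rational.Solver using (module +-*-Solver)
  open +-*-Solver using (solve; con; _:+_; _:*_; _:=_)
  open import Relation.Binary.PropositionalEquality
  open ≡-Reasoning

  open import Defs using (Series; _⊛_; _^ₛ_)
  open Fractions using (fromℕ; fromℕ-+; fromℕ-suc)
  open RangeSum

  conv : Series → Series → Series
  conv f g k = ∑< (suc k) (λ i → f i * g (k ∸ i))

  ⊛≡conv : ∀ f g k → (f ⊛ g) k ≡ conv f g k
  ⊛≡conv f g k = sumUpTo≡∑< k _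

  conv-congˡ : ∀ {f f′} g k → (∀ i → f i ≡ f′ i) → conv f g k ≡ conv f′ g k
  conv-congˡ g k f≡ = ∑<-cong (suc k) (λ i _ → cong (_* g (k ∸ i)) (f≡ i))

  conv-congʳ : ∀ f {g g′} k → (∀ i → g i ≡ g′ i) → conv f g k ≡ conv f g′ k
  conv-congʳ f k g≡ = ∑<-cong (suc k) (λ i _ → cong (f i *_) (g≡ (k ∸ i)))

  conv-congʳ-≤ : ∀ f {g g′} k → (∀ j → j ≤ k → g j ≡ g′ j) → conv f g k ≡ conv f g′ k
  conv-congʳ-≤ f k g≡ = ∑<-cong (suc k) (λ i _ → cong (f i *_) (g≡ (k ∸ i) (ℕ.m∸n≤m k i)))

  conv-comm : ∀ f g k → conv f g k ≡ conv g f k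
  conv-comm f g k = trans (∑<-reverse (suc k) (λ i → f i * g (k ∸ i)))
    (∑<-cong (suc k) λ { i (s≤s i≤k) →
      trans (cong (λ z → f (k ∸ i) * g z) (ℕ.m∸[m∸n]≡n i≤k)) (ℚ.*-comm (f (k ∸ i)) (g i)) })

  conv-assoc : ∀ f g h k → conv (conv f g) h k ≡ conv f (conv g h) k
  conv-assoc f g h k = begin
    ∑< (suc k) (λ j → ∑< (suc j) (λ i → f i * g (j ∸ i)) * h (k ∸ j))
      ≡⟨ ∑<-cong (suc k) (λ j _ → ∑<-*ʳ (suc j) (h (k ∸ j)) (λ i → f i * g (j ∸ i))) ⟩
    ∑< (suc k) (λ j → ∑< (suc j) (λ i → F i j))
      ≡⟨ ∑<-triangle (suc k) F ⟩
    ∑< (suc k) (λ i → ∑< (suc k ∸ i) (λ a → F i (i ℕ.+ a)))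
      ≡⟨ ∑<-cong (suc k) row ⟩
    ∑< (suc k) (λ i → f i * ∑< (suc (k ∸ i)) (λ a → g a * h ((k ∸ i) ∸ a))) ∎
    where
    F : ℕ → ℕ → ℚ
    F i j = (f i * g (j ∸ i)) * h (k ∸ j)
    row : ∀ i → i < suc k → ∑< (suc k ∸ i) (λ a → F i (i ℕ.+ a)) ≡ f i * ∑< (suc (k ∸ i)) (λ a → g a * h ((k ∸ i) ∸ a))
    row i (s≤s i≤k) = begin
      ∑< (suc k ∸ i) (λ a → F i (i ℕ.+ a))
        ≡⟨ cong (λ z → ∑< z (λ a → F i (i ℕ.+ a))) (ℕ.+-∸-assoc 1 i≤k) ⟩
      ∑< (suc (k ∸ i)) (λ a → F i (i ℕ.+ a))
        ≡⟨ ∑<-cong (suc (k ∸ i)) (λ a _ →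
             trans (cong₂ (λ x y → (f i * g x) * h y) (ℕ.m+n∸m≡n i a) (sym (ℕ.∸-+-assoc k i a)))
                   (ℚ.*-assoc (f i) (g a) (h ((k ∸ i) ∸ a)))) ⟩
      ∑< (suc (k ∸ i)) (λ a → f i * (g a * h ((k ∸ i) ∸ a)))
        ≡⟨ sym (∑<-*ˡ (suc (k ∸ i)) (f i) _) ⟩
      f i * ∑< (suc (k ∸ i)) (λ a → g a * h ((k ∸ i) ∸ a)) ∎

  conv-+ʳ : ∀ f g h k → conv f (λ j → g j + h j) k ≡ conv f g k + conv f h k
  conv-+ʳ f g h k = trans (∑<-cong (suc k) (λ i _ → ℚ.*-distribˡ-+ (f i) (g (k ∸ i)) (h (k ∸ i)))) (∑<-+ (suc k) _ _)

  conv-*ʳ : ∀ f c g k → conv f (λ j → c * g j) k ≡ c * conv f g k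
  conv-*ʳ f c g k = trans (∑<-cong (suc k) (λ i _ → x*[c*y]≡c*[x*y] (f i) (g (k ∸ i)))) (sym (∑<-*ˡ (suc k) c _))
    where
    x*[c*y]≡c*[x*y] : ∀ x y → x * (c * y) ≡ c * (x * y)
    x*[c*y]≡c*[x*y] x y = solve 3 (λ x y c → x :* (c :* y) := c :* (x :* y)) refl x y c

  conv-∑ʳ : ∀ f N (G : ℕ → Series) k → conv f (λ j → ∑< N (λ i → G i j)) k ≡ ∑< N (λ i → conv f (G i) k)
  conv-∑ʳ f N G k = begin
    ∑< (suc k) (λ j → f j * ∑< N (λ i → G i (k ∸ j))) ≡⟨ ∑<-cong (suc k) (λ j _ → ∑<-*ˡ N (f j) _) ⟩
    ∑< (suc k) (λ j → ∑< N (λ i → f j * G i (k ∸ j))) ≡⟨ ∑<-comm (suc k) N _ ⟩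
    ∑< N (λ i → conv f (G i) k)                        ∎

  one : Series
  one zero    = 1ℚ
  one (suc _) = 0ℚ

  conv-identityˡ : ∀ f k → conv one f k ≡ f k
  conv-identityˡ f k = begin
    ∑< (suc k) (λ i → one i * f (k ∸ i))       ≡⟨ ∑<-shift k _ ⟩
    1ℚ * f k + ∑< k (λ i → 0ℚ * f (k ∸ suc i))
      ≡⟨ cong₂ _+_ (ℚ.*-identityˡ (f k)) (∑<-zero k _ (λ i _ → ℚ.*-zeroˡ (f (k ∸ suc i)))) ⟩
    f k + 0ℚ                                   ≡⟨ ℚ.+-identityʳ (f k) ⟩
    f k                                        ∎

  ^ₛ-zero : ∀ g k → (g ^ₛ 0) k ≡ one k
  ^ₛ-zero g zero    = refl
  ^ₛ-zero g (suc k) = refl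

  θ : Series → Series
  θ f k = fromℕ k * f k

  θ-conv : ∀ f g k → θ (conv f g) k ≡ conv (θ f) g k + conv f (θ g) k
  θ-conv f g k = begin
    fromℕ k * ∑< (suc k) (λ i → f i * g (k ∸ i))      ≡⟨ ∑<-*ˡ (suc k) (fromℕ k) _ ⟩
    ∑< (suc k) (λ i → fromℕ k * (f i * g (k ∸ i)))    ≡⟨ ∑<-cong (suc k) split ⟩
    ∑< (suc k) (λ i → θ f i * g (k ∸ i) + f i * θ g (k ∸ i)) ≡⟨ ∑<-+ (suc k) _ _ ⟩
    conv (θ f) g k + conv f (θ g) k                     ∎
    where
    split : ∀ i → i < suc k → fromℕ k * (f i * g (k ∸ i)) ≡ θ f i * g (k ∸ i) + f i * θ g (k ∸ i)
    split i (s≤s i≤k) = begin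
      fromℕ k * (f i * g (k ∸ i))                 ≡⟨ cong (λ z → fromℕ z * (f i * g (k ∸ i))) (sym (ℕ.m+[n∸m]≡n i≤k)) ⟩
      fromℕ (i ℕ.+ (k ∸ i)) * (f i * g (k ∸ i))   ≡⟨ cong (_* (f i * g (k ∸ i))) (fromℕ-+ i (k ∸ i)) ⟩
      (fromℕ i + fromℕ (k ∸ i)) * (f i * g (k ∸ i))
        ≡⟨ solve 4 (λ a b x y → (a :+ b) :* (x :* y) := (a :* x) :* y :+ x :* (b :* y)) refl
             (fromℕ i) (fromℕ (k ∸ i)) (f i) (g (k ∸ i)) ⟩
      θ f i * g (k ∸ i) + f i * θ g (k ∸ i)        ∎

  module Powers (g : Series) (g₀≡0 : g 0 ≡ 0ℚ) where

    ^ₛ-suc : ∀ m k → (g ^ₛ suc m) k ≡ conv g (g ^ₛ m) k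
    ^ₛ-suc m k = ⊛≡conv g (g ^ₛ m) k

    ^ₛ-vanishing : ∀ m k → k < m → (g ^ₛ m) k ≡ 0ℚ
    ^ₛ-vanishing (suc m) k (s≤s k≤m) = begin
      (g ^ₛ suc m) k                                      ≡⟨ ^ₛ-suc m k ⟩
      ∑< (suc k) (λ i → g i * (g ^ₛ m) (k ∸ i))          ≡⟨ ∑<-shift k _ ⟩
      g 0 * (g ^ₛ m) k + ∑< k (λ i → g (suc i) * (g ^ₛ m) (k ∸ suc i))
        ≡⟨ cong₂ _+_ (trans (cong (_* (g ^ₛ m) k) g₀≡0) (ℚ.*-zeroˡ ((g ^ₛ m) k))) (∑<-zero k _ lower) ⟩
      0ℚ + 0ℚ                                              ≡⟨ ℚ.+-identityˡ 0ℚ ⟩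
      0ℚ                                                   ∎
      where
      lower : ∀ i → i < k → g (suc i) * (g ^ₛ m) (k ∸ suc i) ≡ 0ℚ
      lower i i<k = trans (cong (g (suc i) *_) (^ₛ-vanishing m (k ∸ suc i) (ℕ.<-≤-trans (∸-suc-< i<k) k≤m)))
                          (ℚ.*-zeroʳ (g (suc i)))
        where
        ∸-suc-< : ∀ {i k} → i < k → k ∸ suc i < k
        ∸-suc-< {i} {suc k} _ = s≤s (ℕ.m∸n≤m k i)

    θ-^ₛ : ∀ m k → θ (g ^ₛ suc m) k ≡ fromℕ (suc m) * conv (g ^ₛ m) (θ g) k
    θ-^ₛ zero k = begin
      fromℕ k * (g ^ₛ 1) k ≡⟨ cong (fromℕ k *_) (trans (^ₛ-suc 0 k) (trans (conv-comm g (g ^ₛ 0) k)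
                                  (trans (conv-congˡ g k (^ₛ-zero g)) (conv-identityˡ g k)))) ⟩
      fromℕ k * g k              ≡⟨ sym (conv-identityˡ (θ g) k) ⟩
      conv one (θ g) k           ≡⟨ sym (conv-congˡ (θ g) k (^ₛ-zero g)) ⟩
      conv (g ^ₛ 0) (θ g) k      ≡⟨ sym (ℚ.*-identityˡ _) ⟩
      1ℚ * conv (g ^ₛ 0) (θ g) k ∎
    θ-^ₛ (suc m) k = begin
      fromℕ k * (g ^ₛ suc (suc m)) k                       ≡⟨ cong (fromℕ k *_) (^ₛ-suc (suc m) k) ⟩
      θ (conv g (g ^ₛ suc m)) k                            ≡⟨ θ-conv g (g ^ₛ suc m) k ⟩
      conv (θ g) (g ^ₛ suc m) k + conv g (θ (g ^ₛ suc m)) k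
        ≡⟨ cong₂ _+_ (conv-comm (θ g) (g ^ₛ suc m) k) (conv-congʳ g k (θ-^ₛ m)) ⟩
      X + conv g (λ j → fromℕ (suc m) * conv (g ^ₛ m) (θ g) j) k
        ≡⟨ cong (X +_) (conv-*ʳ g (fromℕ (suc m)) (conv (g ^ₛ m) (θ g)) k) ⟩
      X + fromℕ (suc m) * conv g (conv (g ^ₛ m) (θ g)) k
        ≡⟨ cong (λ z → X + fromℕ (suc m) * z) (sym (conv-assoc g (g ^ₛ m) (θ g) k)) ⟩
      X + fromℕ (suc m) * conv (conv g (g ^ₛ m)) (θ g) k
        ≡⟨ cong (λ z → X + fromℕ (suc m) * z) (conv-congˡ (θ g) k (λ j → sym (^ₛ-suc m j))) ⟩
      X + fromℕ (suc m) * X                                ≡⟨ solve 2 (λ x t → x :+ t :* x := (con 1ℚ :+ t) :* x) refl X (fromℕ (suc m)) ⟩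
      (1ℚ + fromℕ (suc m)) * X                             ≡⟨ cong (_* X) (sym (fromℕ-suc (suc m))) ⟩
      fromℕ (suc (suc m)) * X                              ∎
      where
      X : ℚ
      X = conv (g ^ₛ suc m) (θ g) k

module CarlitzRecurrence where

  open import Data.Nat as ℕ using (ℕ; zero; suc; _≤_; _<_; _∸_; s≤s; _!)
  import Data.Nat.Properties as ℕ
  open import Data.Nat.Combinatorics using (_C_)
  import Data.Nat.Solver as ℕ-Solver
  open import Data.Integer as ℤ using (ℤ)
  import Data.Integer.Properties as ℤ
  open import Data.Rational as ℚ using (ℚ; 0ℚ; 1ℚ; _+_; _*_; -_)
  import Data.Rational.Properties as ℚ
  open import Data.Rational.Solver using (module +-*-Solver)
  open +-*-Solver using (solve; con; _:+_; _:*_; _:=_; :-_)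
  open import Data.Sum using (_⊎_; inj₁; inj₂)
  open import Relation.Binary.PropositionalEquality hiding (J)
  open import Relation.Nullary using (yes; no)
  open ≡-Reasoning

  open import Defs using (Series; _^ₛ_; sign; J₀2√; gSeries; logJ₀2√; Carlitz)
  open Fractions
  open RangeSum
  open PowerSeries
  open Binomial

  ∑<-telescope : ∀ (s Q : ℕ → ℚ) → (∀ i → s (suc i) ≡ - s i) → ∀ n →
    ∑< (suc n) (λ i → s i * Q i) + ∑< (suc n) (λ i → s i * Q (suc i)) ≡ s 0 * Q 0 + s n * Q (suc n)
  ∑<-telescope s Q s-alt zero = solve 2 (λ a b → (con 0ℚ :+ a) :+ (con 0ℚ :+ b) := a :+ b) refl (s 0 * Q 0) (s 0 * Q 1)
  ∑<-telescope s Q s-alt (suc n) = begin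
    (A + s (suc n) * Q (suc n)) + (B + s (suc n) * Q (suc (suc n)))
      ≡⟨ cong (λ z → (A + z * Q (suc n)) + (B + z * Q (suc (suc n)))) (s-alt n) ⟩
    (A + (- s n) * Q (suc n)) + (B + (- s n) * Q (suc (suc n)))
      ≡⟨ solve 5 (λ a b x y z → (a :+ (:- x) :* y) :+ (b :+ (:- x) :* z) := (a :+ b) :+ (:- x) :* z :+ (:- (x :* y)))
           refl A B (s n) (Q (suc n)) (Q (suc (suc n))) ⟩
    (A + B) + (- s n) * Q (suc (suc n)) + - (s n * Q (suc n))
      ≡⟨ cong (λ z → z + (- s n) * Q (suc (suc n)) + - (s n * Q (suc n))) (∑<-telescope s Q s-alt n) ⟩
    (s 0 * Q 0 + s n * Q (suc n)) + (- s n) * Q (suc (suc n)) + - (s n * Q (suc n))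
      ≡⟨ solve 4 (λ a x y z → (a :+ x :* y) :+ (:- x) :* z :+ (:- (x :* y)) := a :+ (:- x) :* z)
           refl (s 0 * Q 0) (s n) (Q (suc n)) (Q (suc (suc n))) ⟩
    s 0 * Q 0 + (- s n) * Q (suc (suc n))
      ≡⟨ cong (λ z → s 0 * Q 0 + z * Q (suc (suc n))) (sym (s-alt n)) ⟩
    s 0 * Q 0 + s (suc n) * Q (suc (suc n)) ∎
    where
    A B : ℚ
    A = ∑< (suc n) (λ i → s i * Q i)
    B = ∑< (suc n) (λ i → s i * Q (suc i))

  signℚ : ℕ → ℚ
  signℚ i = sign i ℚ./ 1

  signℚ-suc : ∀ i → signℚ (suc i) ≡ - signℚ i
  signℚ-suc i = neg-/ (sign i) 0

  private
    sign≡±1 : ∀ a → sign a ≡ ℤ.+ 1 ⊎ sign a ≡ ℤ.-[1+ 0 ]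
    sign≡±1 zero = inj₁ refl
    sign≡±1 (suc a) with sign≡±1 a
    ... | inj₁ e = inj₂ (cong ℤ.-_ e)
    ... | inj₂ e = inj₁ (cong ℤ.-_ e)

    sign-+ : ∀ a b → sign (a ℕ.+ b) ≡ sign a ℤ.* sign b
    sign-+ zero    b = sym (ℤ.*-identityˡ (sign b))
    sign-+ (suc a) b = trans (cong ℤ.-_ (sign-+ a b)) (ℤ.neg-distribˡ-* (sign a) (sign b))

  signℚ-+ : ∀ a b → signℚ a * signℚ b ≡ signℚ (a ℕ.+ b)
  signℚ-+ a b = trans (/-*-/ (sign a) (sign b) 1 1) (cong (ℚ._/ 1) (sym (sign-+ a b)))

  signℚ-square : ∀ a → signℚ a * signℚ a ≡ 1ℚ
  signℚ-square a = trans (/-*-/ (sign a) (sign a) 1 1) (cong (ℚ._/ 1) (square (sign≡±1 a)))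
    where
    square : sign a ≡ ℤ.+ 1 ⊎ sign a ≡ ℤ.-[1+ 0 ] → sign a ℤ.* sign a ≡ ℤ.+ 1
    square (inj₁ e) rewrite e = refl
    square (inj₂ e) rewrite e = refl

  module LogDerivative where

    open Powers gSeries refl

    J L g : Series
    J = J₀2√
    L = logJ₀2√
    g = gSeries

    J≡one+g : ∀ k → J k ≡ one k + g k
    J≡one+g zero    = sym (ℚ.+-identityʳ 1ℚ)
    J≡one+g (suc k) = sym (ℚ.+-identityˡ (J (suc k)))

    Q : ℕ → Series
    Q i = conv (g ^ₛ i) (θ g)

    Q-suc : ∀ i m → Q (suc i) m ≡ conv g (Q i) m
    Q-suc i m = trans (conv-congˡ (θ g) m (^ₛ-suc i)) (conv-assoc g (g ^ₛ i) (θ g) m)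

    Q-vanishing : ∀ i m → m ≤ i → Q i m ≡ 0ℚ
    Q-vanishing i m m≤i = ∑<-zero (suc m) _ term
      where
      term : ∀ j → j < suc m → (g ^ₛ i) j * θ g (m ∸ j) ≡ 0ℚ
      term j (s≤s j≤m) with j ℕ.<? i
      ... | yes j<i = trans (cong (_* θ g (m ∸ j)) (^ₛ-vanishing i j j<i)) (ℚ.*-zeroˡ (θ g (m ∸ j)))
      ... | no j≮i  = trans (cong (λ z → (g ^ₛ i) j * θ g z) (ℕ.m≤n⇒m∸n≡0 (ℕ.≤-trans m≤i (ℕ.≮⇒≥ j≮i))))
                            (trans (cong ((g ^ₛ i) j *_) (ℚ.*-zeroˡ 0ℚ)) (ℚ.*-zeroʳ ((g ^ₛ i) j)))

    θL : ∀ m → θ L m ≡ ∑< m (λ i → signℚ i * Q i m)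
    θL zero    = ℚ.*-zeroˡ 0ℚ
    θL (suc K) = begin
      fromℕ (suc K) * Defs.sumUpTo K (λ i → c i * (g ^ₛ suc i) (suc K))
        ≡⟨ cong (fromℕ (suc K) *_) (sumUpTo≡∑< K _) ⟩
      fromℕ (suc K) * ∑< (suc K) (λ i → c i * (g ^ₛ suc i) (suc K))
        ≡⟨ ∑<-*ˡ (suc K) (fromℕ (suc K)) _ ⟩
      ∑< (suc K) (λ i → fromℕ (suc K) * (c i * (g ^ₛ suc i) (suc K)))
        ≡⟨ ∑<-cong (suc K) (λ i _ → term i) ⟩
      ∑< (suc K) (λ i → signℚ i * Q i (suc K)) ∎
      where
      c : ℕ → ℚ
      c i = sign i ℚ./ suc i
      c*[1+i]≡sign : ∀ i → c i * fromℕ (suc i) ≡ signℚ i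
      c*[1+i]≡sign i = trans (/-*-/ (sign i) (ℤ.+ suc i) (suc i) 1)
        (/-cross (sign i ℤ.* ℤ.+ suc i) (sign i) (suc i ℕ.* 1) 1 {{ℕ.m*n≢0 (suc i) 1}}
          (trans (ℤ.*-identityʳ _) (cong (λ z → sign i ℤ.* ℤ.+ z) (sym (ℕ.*-identityʳ (suc i))))))
      term : ∀ i → fromℕ (suc K) * (c i * (g ^ₛ suc i) (suc K)) ≡ signℚ i * Q i (suc K)
      term i = begin
        fromℕ (suc K) * (c i * (g ^ₛ suc i) (suc K))
          ≡⟨ solve 3 (λ t c p → t :* (c :* p) := c :* (t :* p)) refl (fromℕ (suc K)) (c i) ((g ^ₛ suc i) (suc K)) ⟩
        c i * θ (g ^ₛ suc i) (suc K)         ≡⟨ cong (c i *_) (θ-^ₛ i (suc K)) ⟩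
        c i * (fromℕ (suc i) * Q i (suc K)) ≡⟨ sym (ℚ.*-assoc (c i) (fromℕ (suc i)) (Q i (suc K))) ⟩
        (c i * fromℕ (suc i)) * Q i (suc K) ≡⟨ cong (_* Q i (suc K)) (c*[1+i]≡sign i) ⟩
        signℚ i * Q i (suc K)               ∎

    θL-padded : ∀ m N → m ≤ N → θ L m ≡ ∑< N (λ i → signℚ i * Q i m)
    θL-padded m N m≤N = trans (θL m) (sym (∑<-vanishing m N _ m≤N
      (λ i m≤i → trans (cong (signℚ i *_) (Q-vanishing i m m≤i)) (ℚ.*-zeroʳ (signℚ i)))))

    -- log′ J = J′ / J, multiplied out; the sum over the powers of g telescopes.
    θL*J≡θJ : ∀ m → conv (θ L) J m ≡ θ J m
    θL*J≡θJ m = begin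
      conv (θ L) J m                                   ≡⟨ conv-congʳ (θ L) m J≡one+g ⟩
      conv (θ L) (λ j → one j + g j) m                 ≡⟨ conv-+ʳ (θ L) one g m ⟩
      conv (θ L) one m + conv (θ L) g m
        ≡⟨ cong₂ _+_ (trans (conv-comm (θ L) one m) (conv-identityˡ (θ L) m)) (conv-comm (θ L) g m) ⟩
      θ L m + conv g (θ L) m
        ≡⟨ cong₂ _+_ (θL-padded m N (ℕ.n≤1+n m)) (conv-congʳ-≤ g m (λ j j≤m → θL-padded j N (ℕ.≤-trans j≤m (ℕ.n≤1+n m)))) ⟩
      Σ₀ + conv g (λ j → ∑< N (λ i → signℚ i * Q i j)) m
        ≡⟨ cong (Σ₀ +_) (conv-∑ʳ g N (λ i j → signℚ i * Q i j) m) ⟩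
      Σ₀ + ∑< N (λ i → conv g (λ j → signℚ i * Q i j) m)
        ≡⟨ cong (Σ₀ +_) (∑<-cong N (λ i _ → trans (conv-*ʳ g (signℚ i) (Q i) m) (cong (signℚ i *_) (sym (Q-suc i m))))) ⟩
      Σ₀ + ∑< N (λ i → signℚ i * Q (suc i) m)          ≡⟨ ∑<-telescope signℚ (λ i → Q i m) signℚ-suc m ⟩
      1ℚ * Q 0 m + signℚ m * Q (suc m) m
        ≡⟨ cong₂ _+_ (ℚ.*-identityˡ (Q 0 m)) (trans (cong (signℚ m *_) (Q-vanishing (suc m) m (ℕ.n≤1+n m))) (ℚ.*-zeroʳ (signℚ m))) ⟩
      Q 0 m + 0ℚ                                       ≡⟨ ℚ.+-identityʳ (Q 0 m) ⟩
      Q 0 m                                            ≡⟨ conv-congˡ (θ g) m (^ₛ-zero g) ⟩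
      conv one (θ g) m                                 ≡⟨ conv-identityˡ (θ g) m ⟩
      θ g m                                            ≡⟨ sym (ℚ.+-identityˡ (θ g m)) ⟩
      0ℚ + θ g m                                       ≡⟨ cong (_+ θ g m) (sym (θ-one m)) ⟩
      θ one m + θ g m                                  ≡⟨ sym (ℚ.*-distribˡ-+ (fromℕ m) (one m) (g m)) ⟩
      fromℕ m * (one m + g m)                          ≡⟨ cong (fromℕ m *_) (sym (J≡one+g m)) ⟩
      θ J m                                            ∎
      where
      N : ℕ
      N = suc m
      Σ₀ : ℚ
      Σ₀ = ∑< N (λ i → signℚ i * Q i m)
      θ-one : ∀ m → θ one m ≡ 0ℚ
      θ-one zero    = ℚ.*-zeroˡ 1ℚ
      θ-one (suc m) = ℚ.*-zeroʳ (fromℕ (suc m))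

    private
      nonZero-k!² : ∀ k → ℕ.NonZero (k ! ℕ.* k !)
      nonZero-k!² k = ℕ.m*n≢0 (k !) (k !) {{k ℕ.!≢0}} {{k ℕ.!≢0}}

    J-coefficient : ∀ k → J k * fromℕ (k ! ℕ.* k !) ≡ signℚ k
    J-coefficient k = trans (/-*-/ (sign k) (ℤ.+ (k ! ℕ.* k !)) (k ! ℕ.* k !) 1 {{nonZero-k!² k}})
      (/-cross (sign k ℤ.* ℤ.+ (k ! ℕ.* k !)) (sign k) ((k ! ℕ.* k !) ℕ.* 1) 1
         {{ℕ.m*n≢0 (k ! ℕ.* k !) 1 {{nonZero-k!² k}}}}
         (trans (ℤ.*-identityʳ _) (cong (λ z → sign k ℤ.* ℤ.+ z) (sym (ℕ.*-identityʳ (k ! ℕ.* k !))))))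

    L-coefficient : ∀ k → L k * fromℕ (k ! ℕ.* k !) ≡ signℚ k * Carlitz k
    L-coefficient k = begin
      L k * T                         ≡⟨ sym (ℚ.*-identityˡ (L k * T)) ⟩
      1ℚ * (L k * T)                  ≡⟨ cong (_* (L k * T)) (sym (signℚ-square k)) ⟩
      (signℚ k * signℚ k) * (L k * T) ≡⟨ solve 3 (λ a l t → (a :* a) :* (l :* t) := a :* ((a :* t) :* l)) refl (signℚ k) (L k) T ⟩
      signℚ k * Carlitz k             ∎
      where
      T : ℚ
      T = fromℕ (k ! ℕ.* k !)

    private
      *-cancelˡ-fromℕ : ∀ n {X Y} → fromℕ (suc n) * X ≡ fromℕ (suc n) * Y → X ≡ Y
      *-cancelˡ-fromℕ n {X} {Y} e = begin
        X                          ≡⟨ sym (ℚ.*-identityˡ X) ⟩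
        1ℚ * X                     ≡⟨ cong (_* X) (sym (1/n*n≡1 (suc n))) ⟩
        (1/[1+n] * fromℕ (suc n)) * X ≡⟨ ℚ.*-assoc 1/[1+n] _ X ⟩
        1/[1+n] * (fromℕ (suc n) * X) ≡⟨ cong (1/[1+n] *_) e ⟩
        1/[1+n] * (fromℕ (suc n) * Y) ≡⟨ sym (ℚ.*-assoc 1/[1+n] _ Y) ⟩
        (1/[1+n] * fromℕ (suc n)) * Y ≡⟨ cong (_* Y) (1/n*n≡1 (suc n)) ⟩
        1ℚ * Y                     ≡⟨ ℚ.*-identityˡ Y ⟩
        Y                          ∎
        where
        1/[1+n] : ℚ
        1/[1+n] = ℤ.+ 1 ℚ./ suc n

    -- Read off at z^(M+1), scaled by (-1)^(M+1) (M+1)!² / (M+1).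
    module _ (M : ℕ) where

      private
        F : ℕ
        F = suc M !
        sM scale : ℚ
        sM = signℚ (suc M)
        scale = sM * fromℕ (F ℕ.* F)

      coefficient : ∀ j → j ≤ M →
        (θ L (suc j) * J (M ∸ j)) * scale ≡ fromℕ (suc M) * (fromℕ ((M C j) ℕ.* (suc M C suc j)) * Carlitz (suc j))
      coefficient j j≤M = begin
        (t * L (suc j) * J (M ∸ j)) * (sM * fromℕ (F ℕ.* F))
          ≡⟨ cong (λ z → (t * L (suc j) * J (M ∸ j)) * (sM * z)) F²-split ⟩
        (t * L (suc j) * J (M ∸ j)) * (sM * (X * (Y * Z)))
          ≡⟨ solve 7 (λ t l jj sm x y z → (t :* l :* jj) :* (sm :* (x :* (y :* z))) := (t :* x) :* ((l :* y) :* (jj :* z) :* sm))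
               refl t (L (suc j)) (J (M ∸ j)) sM X Y Z ⟩
        (t * X) * ((L (suc j) * Y) * (J (M ∸ j) * Z) * sM)
          ≡⟨ cong₂ (λ u v → (t * X) * (u * v * sM)) (L-coefficient (suc j)) (J-coefficient (M ∸ j)) ⟩
        (t * X) * ((signℚ (suc j) * Carlitz (suc j)) * signℚ (M ∸ j) * sM)
          ≡⟨ solve 5 (λ p a c b m → p :* ((a :* c) :* b :* m) := p :* (c :* ((a :* b) :* m)))
               refl (t * X) (signℚ (suc j)) (Carlitz (suc j)) (signℚ (M ∸ j)) sM ⟩
        (t * X) * (Carlitz (suc j) * ((signℚ (suc j) * signℚ (M ∸ j)) * sM))
          ≡⟨ cong₂ (λ u v → u * (Carlitz (suc j) * v)) tX signs ⟩
        (fromℕ (suc M) * fromℕ B) * (Carlitz (suc j) * 1ℚ)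
          ≡⟨ solve 3 (λ m b c → (m :* b) :* (c :* con 1ℚ) := m :* (b :* c)) refl (fromℕ (suc M)) (fromℕ B) (Carlitz (suc j)) ⟩
        fromℕ (suc M) * (fromℕ B * Carlitz (suc j)) ∎
        where
        t X Y Z : ℚ
        t = fromℕ (suc j)
        b a c B : ℕ
        b = suc M C suc j
        a = suc j !
        c = (M ∸ j) !
        B = (M C j) ℕ.* b
        X = fromℕ (b ℕ.* b)
        Y = fromℕ (a ℕ.* a)
        Z = fromℕ (c ℕ.* c)
        open ℕ-Solver.+-*-Solver using () renaming (solve to solveℕ; _:*_ to _⊠_; _:=_ to _≐_)
        F²-split : fromℕ (F ℕ.* F) ≡ X * (Y * Z)
        F²-split = begin
          fromℕ (F ℕ.* F)
            ≡⟨ cong (λ z → fromℕ (z ℕ.* z)) (sym (nCk*k!*[n∸k]!≡n! (s≤s j≤M))) ⟩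
          fromℕ ((b ℕ.* (a ℕ.* c)) ℕ.* (b ℕ.* (a ℕ.* c)))
            ≡⟨ cong fromℕ (solveℕ 3 (λ b a c → (b ⊠ (a ⊠ c)) ⊠ (b ⊠ (a ⊠ c)) ≐ (b ⊠ b) ⊠ ((a ⊠ a) ⊠ (c ⊠ c))) refl b a c) ⟩
          fromℕ ((b ℕ.* b) ℕ.* ((a ℕ.* a) ℕ.* (c ℕ.* c)))
            ≡⟨ trans (fromℕ-* (b ℕ.* b) _) (cong (X *_) (fromℕ-* (a ℕ.* a) (c ℕ.* c))) ⟩
          X * (Y * Z) ∎
        signs : (signℚ (suc j) * signℚ (M ∸ j)) * sM ≡ 1ℚ
        signs = trans (cong (_* sM) (trans (signℚ-+ (suc j) (M ∸ j)) (cong (λ z → signℚ (suc z)) (ℕ.m+[n∸m]≡n j≤M))))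
                      (signℚ-square (suc M))
        tX : t * X ≡ fromℕ (suc M) * fromℕ B
        tX = begin
          t * X                          ≡⟨ sym (fromℕ-* (suc j) (b ℕ.* b)) ⟩
          fromℕ (suc j ℕ.* (b ℕ.* b))   ≡⟨ cong fromℕ (sym (ℕ.*-assoc (suc j) b b)) ⟩
          fromℕ ((suc j ℕ.* b) ℕ.* b)   ≡⟨ cong (λ z → fromℕ (z ℕ.* b)) ([k+1]*[n+1]C[k+1]≡[n+1]*nCk M j) ⟩
          fromℕ ((suc M ℕ.* (M C j)) ℕ.* b) ≡⟨ cong fromℕ (ℕ.*-assoc (suc M) (M C j) b) ⟩
          fromℕ (suc M ℕ.* B)           ≡⟨ fromℕ-* (suc M) B ⟩
          fromℕ (suc M) * fromℕ B       ∎

      carlitz-recurrence : ∑< (suc M) (λ j → fromℕ ((M C j) ℕ.* (suc M C suc j)) * Carlitz (suc j)) ≡ 1ℚ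
      carlitz-recurrence = *-cancelˡ-fromℕ M (begin
        fromℕ (suc M) * ∑< (suc M) f                        ≡⟨ ∑<-*ˡ (suc M) (fromℕ (suc M)) f ⟩
        ∑< (suc M) (λ j → fromℕ (suc M) * f j)               ≡⟨ sym (∑<-cong (suc M) (λ j j<1+M → coefficient j (ℕ.≤-pred j<1+M))) ⟩
        ∑< (suc M) (λ j → (θ L (suc j) * J (M ∸ j)) * scale) ≡⟨ sym (∑<-*ʳ (suc M) scale _) ⟩
        ∑< (suc M) (λ j → θ L (suc j) * J (M ∸ j)) * scale   ≡⟨ cong (_* scale) θL*J-at-1+M ⟩
        θ J (suc M) * scale
          ≡⟨ solve 4 (λ t jj sm ff → (t :* jj) :* (sm :* ff) := t :* ((jj :* ff) :* sm)) refl (fromℕ (suc M)) (J (suc M)) sM (fromℕ (F ℕ.* F)) ⟩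
        fromℕ (suc M) * ((J (suc M) * fromℕ (F ℕ.* F)) * sM) ≡⟨ cong (λ z → fromℕ (suc M) * (z * sM)) (J-coefficient (suc M)) ⟩
        fromℕ (suc M) * (sM * sM)                             ≡⟨ cong (fromℕ (suc M) *_) (signℚ-square (suc M)) ⟩
        fromℕ (suc M) * 1ℚ                                    ∎)
        where
        f : ℕ → ℚ
        f j = fromℕ ((M C j) ℕ.* (suc M C suc j)) * Carlitz (suc j)
        θL*J-at-1+M : ∑< (suc M) (λ j → θ L (suc j) * J (M ∸ j)) ≡ θ J (suc M)
        θL*J-at-1+M = trans (sym (begin
          conv (θ L) J (suc M)              ≡⟨ ∑<-shift (suc M) (λ i → θ L i * J (suc M ∸ i)) ⟩
          θ L 0 * J (suc M) + R             ≡⟨ cong (_+ R) (trans (cong (_* J (suc M)) (ℚ.*-zeroˡ 0ℚ)) (ℚ.*-zeroˡ (J (suc M)))) ⟩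
          0ℚ + R                            ≡⟨ ℚ.+-identityˡ R ⟩
          R                                 ∎)) (θL*J≡θJ (suc M))
          where
          R : ℚ
          R = ∑< (suc M) (λ j → θ L (suc j) * J (M ∸ j))

  open LogDerivative public using (carlitz-recurrence)

module Enumeration where

  open import Data.Bool using (Bool; true; false)
  open import Data.List using (List; []; _∷_; map; concatMap)
  open import Data.List.Membership.Propositional using (_∈_)
  open import Data.List.Membership.Propositional.Properties using (∈-concatMap⁺; ∈-map⁺; ∈-map⁻; ∈-++⁻)
  open import Data.List.Relation.Binary.Disjoint.Propositional using (Disjoint)
  open import Data.List.Relation.Unary.All as All using ([]; _∷_)
  open import Data.List.Relation.Unary.AllPairs using ([]; _∷_)
  open import Data.List.Relation.Unary.Any as Any using (here; there)
  open import Data.List.Relation.Unary.Unique.Propositional using (Unique)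
  import Data.List.Relation.Unary.Unique.Propositional.Properties as Unique
  open import Data.Nat using (zero; suc)
  open import Data.Product using (_,_)
  open import Data.Sum using (inj₁; inj₂)
  open import Data.Vec as Vec using (Vec)
  open import Relation.Binary.PropositionalEquality using (refl)

  open import Defs using (allVecs; Relation)

  module _ {a} {A : Set a} where

    allVecs-complete : ∀ (xs : List A) k → (∀ x → x ∈ xs) → ∀ v → v ∈ allVecs xs k
    allVecs-complete xs zero    complete Vec.[]        = here refl
    allVecs-complete xs (suc k) complete (x Vec.∷ v) =
      ∈-concatMap⁺ (λ y → map (y Vec.∷_) (allVecs xs k))
        (Any.map (λ { refl → ∈-map⁺ (x Vec.∷_) (allVecs-complete xs k complete v) }) (complete x))

    private
      head-∈ : ∀ {k} (xs ys : List A) {v : Vec A (suc k)} →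
               v ∈ concatMap (λ y → map (y Vec.∷_) (allVecs xs k)) ys → Vec.head v ∈ ys
      head-∈ xs (y ∷ ys) v∈ with ∈-++⁻ (map (y Vec.∷_) (allVecs xs _)) v∈
      ... | inj₁ v∈y with ∈-map⁻ (y Vec.∷_) v∈y
      ...   | _ , _ , refl = here refl
      head-∈ xs (y ∷ ys) v∈ | inj₂ v∈ys = there (head-∈ xs ys v∈ys)

    allVecs-unique : ∀ (xs : List A) k → Unique xs → Unique (allVecs xs k)
    allVecs-unique xs zero    _  = [] ∷ []
    allVecs-unique xs (suc k) ux = go xs ux
      where
      go : ∀ ys → Unique ys → Unique (concatMap (λ y → map (y Vec.∷_) (allVecs xs k)) ys)
      go []       _          = []
      go (y ∷ ys) (y∉ ∷ uys) = Unique.++⁺ (Unique.map⁺ (λ { refl → refl }) (allVecs-unique xs k ux)) (go ys uys) disjoint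
        where
        disjoint : Disjoint (map (y Vec.∷_) (allVecs xs k)) (concatMap (λ y → map (y Vec.∷_) (allVecs xs k)) ys)
        disjoint (v∈y , v∈ys) with ∈-map⁻ (y Vec.∷_) v∈y
        ... | _ , _ , refl = All.lookup y∉ (head-∈ xs ys v∈ys) refl

  bools : List Bool
  bools = true ∷ false ∷ []

  bools-unique : Unique bools
  bools-unique = ((λ ()) ∷ []) ∷ ([] ∷ [])

  bools-complete : ∀ b → b ∈ bools
  bools-complete true  = here refl
  bools-complete false = there (here refl)

  allSubsets : ∀ q → List (Vec Bool q)
  allSubsets = allVecs bools

  allSubsets-unique : ∀ q → Unique (allSubsets q)
  allSubsets-unique q = allVecs-unique bools q bools-unique

  allSubsets-complete : ∀ {q} (S : Vec Bool q) → S ∈ allSubsets q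
  allSubsets-complete {q} = allVecs-complete bools q bools-complete

  allRelations : ∀ q → List (Relation q)
  allRelations q = allVecs (allSubsets q) q

  allRelations-unique : ∀ q → Unique (allRelations q)
  allRelations-unique q = allVecs-unique (allSubsets q) q (allSubsets-unique q)

  allRelations-complete : ∀ {q} (M : Relation q) → M ∈ allRelations q
  allRelations-complete {q} = allVecs-complete (allSubsets q) q allSubsets-complete

module ListProduct where

  open import Data.Bool using (true; false; if_then_else_)
  open import Data.List using (List; []; _∷_; filter; foldr)
  open import Data.List.Membership.Propositional using (_∈_)
  open import Data.List.Relation.Unary.All as All using ()
  open import Data.List.Relation.Unary.Any using (here; there)
  open import Data.List.Relation.Unary.AllPairs using (_∷_)
  open import Data.List.Relation.Unary.Unique.Propositional using (Unique)
  open import Data.Empty using (⊥-elim)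
  open import Data.Rational using (ℚ; 1ℚ; _*_)
  import Data.Rational.Properties as ℚ
  open import Relation.Binary.PropositionalEquality
  open import Relation.Nullary using (Dec; yes; no; does)
  open import Relation.Unary using (Pred; Decidable)
  open ≡-Reasoning

  ∏ : ∀ {a} {A : Set a} → List A → (A → ℚ) → ℚ
  ∏ xs f = foldr (λ x acc → f x * acc) 1ℚ xs

  module _ {a} {A : Set a} where

    ∏-cong-∈ : ∀ (xs : List A) {f g : A → ℚ} → (∀ x → x ∈ xs → f x ≡ g x) → ∏ xs f ≡ ∏ xs g
    ∏-cong-∈ []       f≡g = refl
    ∏-cong-∈ (x ∷ xs) f≡g = cong₂ _*_ (f≡g x (here refl)) (∏-cong-∈ xs (λ y y∈ → f≡g y (there y∈)))

    ∏-one : ∀ (xs : List A) {f : A → ℚ} → (∀ x → x ∈ xs → f x ≡ 1ℚ) → ∏ xs f ≡ 1ℚ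
    ∏-one []       f≡1 = refl
    ∏-one (x ∷ xs) f≡1 = trans (cong₂ _*_ (f≡1 x (here refl)) (∏-one xs (λ y y∈ → f≡1 y (there y∈)))) (ℚ.*-identityˡ 1ℚ)

    ∏-filter : ∀ {p} {P : Pred A p} (P? : Decidable P) (xs : List A) (f : A → ℚ) →
               ∏ (filter P? xs) f ≡ ∏ xs (λ x → if does (P? x) then f x else 1ℚ)
    ∏-filter P? []       f = refl
    ∏-filter P? (x ∷ xs) f with does (P? x)
    ... | true  = cong (f x *_) (∏-filter P? xs f)
    ... | false = trans (∏-filter P? xs f) (sym (ℚ.*-identityˡ _))

    module _ (_≟_ : (x y : A) → Dec (x ≡ y)) where

      private
        except : A → (A → ℚ) → A → ℚ
        except x₀ f x = if does (x ≟ x₀) then 1ℚ else f x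

        except-cong : ∀ x₀ (f g : A → ℚ) → (∀ x → x ≢ x₀ → f x ≡ g x) → ∀ x → except x₀ f x ≡ except x₀ g x
        except-cong x₀ f g f≡g x with x ≟ x₀
        ... | yes _   = refl
        ... | no x≢x₀ = f≡g x x≢x₀

        ∏-split : ∀ (xs : List A) {x₀} (f : A → ℚ) → Unique xs → x₀ ∈ xs → ∏ xs f ≡ f x₀ * ∏ xs (except x₀ f)
        ∏-split (x ∷ xs) {x₀} f (x∉ ∷ u) x₀∈ with x ≟ x₀
        ... | yes refl = cong (f x *_) (trans (∏-cong-∈ xs unchanged) (sym (ℚ.*-identityˡ _)))
          where
          unchanged : ∀ y → y ∈ xs → f y ≡ except x₀ f y
          unchanged y y∈ with y ≟ x₀
          ... | yes refl = ⊥-elim (All.lookup x∉ y∈ refl)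
          ... | no _     = refl
        ... | no x≢x₀ with x₀∈
        ...   | here e    = ⊥-elim (x≢x₀ (sym e))
        ...   | there x₀∈xs = begin
          f x * ∏ xs f                         ≡⟨ cong (f x *_) (∏-split xs f u x₀∈xs) ⟩
          f x * (f x₀ * ∏ xs (except x₀ f))    ≡⟨ sym (ℚ.*-assoc (f x) (f x₀) _) ⟩
          (f x * f x₀) * ∏ xs (except x₀ f)    ≡⟨ cong (_* ∏ xs (except x₀ f)) (ℚ.*-comm (f x) (f x₀)) ⟩
          (f x₀ * f x) * ∏ xs (except x₀ f)    ≡⟨ ℚ.*-assoc (f x₀) (f x) _ ⟩
          f x₀ * (f x * ∏ xs (except x₀ f))    ∎

      ∏-update : ∀ (xs : List A) {x₀} (f g : A → ℚ) (c : ℚ) → Unique xs → x₀ ∈ xs →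
                 f x₀ ≡ c * g x₀ → (∀ x → x ≢ x₀ → f x ≡ g x) → ∏ xs f ≡ c * ∏ xs g
      ∏-update xs {x₀} f g c u x₀∈ f₀ f≡g = begin
        ∏ xs f                                ≡⟨ ∏-split xs f u x₀∈ ⟩
        f x₀ * ∏ xs (except x₀ f)             ≡⟨ cong₂ _*_ f₀ (∏-cong-∈ xs (λ x _ → except-cong x₀ f g f≡g x)) ⟩
        (c * g x₀) * ∏ xs (except x₀ g)       ≡⟨ ℚ.*-assoc c (g x₀) _ ⟩
        c * (g x₀ * ∏ xs (except x₀ g))       ≡⟨ cong (c *_) (sym (∏-split xs g u x₀∈)) ⟩
        c * ∏ xs g                            ∎

module Subsets where

  open import Data.Bool as Bool using (Bool; true; false; T; _∧_; _∨_; not)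
  import Data.Bool.Properties as Bool
  open import Data.Empty using (⊥-elim)
  open import Data.Fin as Fin using (Fin; zero; suc; toℕ)
  import Data.Fin.Properties as Fin
  open import Data.List as List using (List; []; _∷_; filter; map; length; allFin)
  import Data.List.Properties as List
  open import Data.Nat as ℕ using (ℕ; zero; suc; _≤_; _<_; z≤n; s≤s)
  import Data.Nat.Properties as ℕ
  open import Data.Product using (Σ; _×_; _,_; proj₂)
  open import Data.Unit using (tt)
  open import Data.Vec using (Vec; []; _∷_; lookup; tabulate; zipWith)
  import Data.Vec.Properties as Vec
  open import Function using (_∘_; id)
  open import Function.Bundles using (Equivalence)
  open import Relation.Binary.PropositionalEquality
  open import Relation.Nullary using (Dec; yes; no; does; ¬_)
  open import Relation.Nullary.Decidable using (dec-true; dec-false)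
  open import Relation.Unary using (Pred; Decidable)

  Subset : ℕ → Set
  Subset = Vec Bool

  _∈ₛ_ : ∀ {q} → Fin q → Subset q → Set
  i ∈ₛ S = T (lookup S i)

  _⊆ₛ_ : ∀ {q} → Subset q → Subset q → Set
  S ⊆ₛ S′ = ∀ i → i ∈ₛ S → i ∈ₛ S′

  bit : Bool → ℕ
  bit true  = 1
  bit false = 0

  size : ∀ {q} → Subset q → ℕ
  size []      = 0
  size (b ∷ S) = bit b ℕ.+ size S

  size≤ : ∀ {q} (S : Subset q) → size S ≤ q
  size≤ []          = z≤n
  size≤ (true ∷ S)  = s≤s (size≤ S)
  size≤ (false ∷ S) = ℕ.m≤n⇒m≤1+n (size≤ S)

  size-pos : ∀ {q} (S : Subset q) {i} → i ∈ₛ S → 1 ≤ size S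
  size-pos (true ∷ S) {zero}  _   = s≤s z≤n
  size-pos (b ∷ S)    {suc i} i∈S = ℕ.≤-trans (size-pos S i∈S) (ℕ.m≤n+m (size S) (bit b))

  size-mono : ∀ {q} (Z X : Subset q) → Z ⊆ₛ X → size Z ≤ size X
  size-mono []          []          Z⊆X = z≤n
  size-mono (true ∷ Z)  (true ∷ X)  Z⊆X = s≤s (size-mono Z X (Z⊆X ∘ suc))
  size-mono (true ∷ Z)  (false ∷ X) Z⊆X = ⊥-elim (Z⊆X zero tt)
  size-mono (false ∷ Z) (true ∷ X)  Z⊆X = ℕ.m≤n⇒m≤1+n (size-mono Z X (Z⊆X ∘ suc))
  size-mono (false ∷ Z) (false ∷ X) Z⊆X = size-mono Z X (Z⊆X ∘ suc)

  private
    length-filter-map : ∀ {a b p} {A : Set a} {B : Set b} {P : Pred B p} (P? : Decidable P) (g : A → B) xs →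
      length (filter P? (map g xs)) ≡ length (filter (P? ∘ g) xs)
    length-filter-map P? g []       = refl
    length-filter-map P? g (x ∷ xs) with does (P? (g x))
    ... | true  = cong suc (length-filter-map P? g xs)
    ... | false = length-filter-map P? g xs

  size-count-tail : ∀ {q} {b} (S : Subset q) →
    length (filter (λ j → Bool.T? (lookup (b ∷ S) j)) (List.tabulate Fin.suc)) ≡ size S

  size-count : ∀ {q} (S : Subset q) → length (filter (λ j → Bool.T? (lookup S j)) (allFin q)) ≡ size S
  size-count []                  = refl
  size-count {suc q} (true ∷ S)  = cong suc (size-count-tail S)
  size-count {suc q} (false ∷ S) = size-count-tail S

  size-count-tail {q} {b} S = begin
    length (filter P? (List.tabulate Fin.suc))     ≡⟨ cong (length ∘ filter P?) (sym (List.map-tabulate id Fin.suc)) ⟩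
    length (filter P? (map Fin.suc (allFin q)))    ≡⟨ length-filter-map P? Fin.suc (allFin q) ⟩
    length (filter (P? ∘ Fin.suc) (allFin q))      ≡⟨ size-count S ⟩
    size S                                         ∎
    where
    open ≡-Reasoning
    P? = λ j → Bool.T? (lookup (b ∷ S) j)

  _─_ : ∀ {q} → Subset q → Subset q → Subset q
  S ─ S′ = zipWith (λ s t → s ∧ not t) S S′

  lookup-─ : ∀ {q} (S S′ : Subset q) i → lookup (S ─ S′) i ≡ lookup S i ∧ not (lookup S′ i)
  lookup-─ S S′ i = Vec.lookup-zipWith _ i S S′

  ∈-─⁻ : ∀ {q} (S S′ : Subset q) {i} → i ∈ₛ (S ─ S′) → i ∈ₛ S × ¬ i ∈ₛ S′
  ∈-─⁻ S S′ {i} i∈ with Equivalence.to Bool.T-∧ (subst T (lookup-─ S S′ i) i∈)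
  ... | i∈S , i∉S′ = i∈S , T-not⁻ i∉S′
    where
    T-not⁻ : ∀ {b} → T (not b) → ¬ T b
    T-not⁻ {false} _ ()

  ∈-─⁺ : ∀ {q} (S S′ : Subset q) {i} → i ∈ₛ S → ¬ i ∈ₛ S′ → i ∈ₛ (S ─ S′)
  ∈-─⁺ S S′ {i} i∈S i∉S′ = subst T (sym (lookup-─ S S′ i)) (Equivalence.from Bool.T-∧ (i∈S , T-not⁺ i∉S′))
    where
    T-not⁺ : ∀ {b} → ¬ T b → T (not b)
    T-not⁺ {false} _  = tt
    T-not⁺ {true}  ¬t = ¬t tt

  size-─ : ∀ {q} (S S′ : Subset q) → S′ ⊆ₛ S → size S ≡ size (S ─ S′) ℕ.+ size S′
  size-─ []          []           _    = refl
  size-─ (true ∷ S)  (true ∷ S′)  S′⊆S = trans (cong suc (size-─ S S′ (S′⊆S ∘ suc))) (sym (ℕ.+-suc _ _))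
  size-─ (false ∷ S) (true ∷ S′)  S′⊆S = ⊥-elim (S′⊆S zero tt)
  size-─ (true ∷ S)  (false ∷ S′) S′⊆S = cong suc (size-─ S S′ (S′⊆S ∘ suc))
  size-─ (false ∷ S) (false ∷ S′) S′⊆S = size-─ S S′ (S′⊆S ∘ suc)

  ⁅_⁆ : ∀ {q} → Fin q → Subset q
  ⁅ i₀ ⁆ = tabulate (λ i → does (i Fin.≟ i₀))

  lookup-⁅⁆ : ∀ {q} (i₀ i : Fin q) → lookup ⁅ i₀ ⁆ i ≡ does (i Fin.≟ i₀)
  lookup-⁅⁆ i₀ = Vec.lookup∘tabulate (λ i → does (i Fin.≟ i₀))

  ∈-⁅⁆⁻ : ∀ {q} {i₀ i : Fin q} → i ∈ₛ ⁅ i₀ ⁆ → i ≡ i₀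
  ∈-⁅⁆⁻ {i₀ = i₀} {i} i∈ with i Fin.≟ i₀ | subst T (lookup-⁅⁆ i₀ i) i∈
  ... | yes i≡i₀ | _ = i≡i₀

  i∈⁅i⁆ : ∀ {q} (i : Fin q) → i ∈ₛ ⁅ i ⁆
  i∈⁅i⁆ i = subst T (sym (trans (lookup-⁅⁆ i i) (dec-true (i Fin.≟ i) refl))) tt

  size-⁅⁆ : ∀ {q} (i₀ : Fin q) → size ⁅ i₀ ⁆ ≡ 1
  size-⁅⁆ {suc q} zero     = cong suc (size-⁅zero⁆-tail q)
    where
    size-⁅zero⁆-tail : ∀ q → size (tabulate {n = q} (λ i → does (suc i Fin.≟ zero))) ≡ 0
    size-⁅zero⁆-tail zero    = refl
    size-⁅zero⁆-tail (suc q) = size-⁅zero⁆-tail q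
  size-⁅⁆ {suc q} (suc i₀) = begin
    bit (does (zero Fin.≟ suc i₀)) ℕ.+ size (tabulate (λ i → does (suc i Fin.≟ suc i₀)))
      ≡⟨ cong₂ (λ b S → bit b ℕ.+ size S) (dec-false (zero Fin.≟ suc i₀) (λ ())) (Vec.tabulate-cong suc≟suc) ⟩
    size ⁅ i₀ ⁆ ≡⟨ size-⁅⁆ i₀ ⟩
    1 ∎
    where
    open ≡-Reasoning
    suc≟suc : ∀ i → does (suc i Fin.≟ suc i₀) ≡ does (i Fin.≟ i₀)
    suc≟suc i with i Fin.≟ i₀
    ... | yes _ = refl
    ... | no _  = refl

  private
    T-does⁻ : ∀ {p} {P : Set p} (P? : Dec P) → T (does P?) → P
    T-does⁻ (yes p) _ = p

    T-does⁺ : ∀ {p} {P : Set p} (P? : Dec P) → P → T (does P?)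
    T-does⁺ P? p = subst T (sym (dec-true P? p)) tt

  fibre : ∀ {q n} → Subset q → Vec (Fin n) q → Fin n → Subset q
  fibre S u a = zipWith (λ s x → s ∧ does (x Fin.≟ a)) S u

  ∈-fibre⁻ : ∀ {q n} (S : Subset q) (u : Vec (Fin n) q) {a i} → i ∈ₛ fibre S u a → i ∈ₛ S × lookup u i ≡ a
  ∈-fibre⁻ S u {a} {i} i∈ with Equivalence.to Bool.T-∧ (subst T (Vec.lookup-zipWith _ i S u) i∈)
  ... | i∈S , ui≡a = i∈S , T-does⁻ (lookup u i Fin.≟ a) ui≡a

  ∈-fibre⁺ : ∀ {q n} (S : Subset q) (u : Vec (Fin n) q) {a i} → i ∈ₛ S → lookup u i ≡ a → i ∈ₛ fibre S u a
  ∈-fibre⁺ S u {a} {i} i∈S ui≡a = subst T (sym (Vec.lookup-zipWith _ i S u))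
    (Equivalence.from Bool.T-∧ (i∈S , T-does⁺ (lookup u i Fin.≟ a) ui≡a))

  least : ∀ {q} (S : Subset q) {i} → i ∈ₛ S → Σ (Fin q) λ i₀ → i₀ ∈ₛ S × (∀ j → toℕ j < toℕ i₀ → ¬ j ∈ₛ S)
  least (true ∷ S)  _               = zero , tt , λ j ()
  least (false ∷ S) {suc i} i∈S with least S i∈S
  ... | i₀ , i₀∈S , i₀-least = suc i₀ , i₀∈S , λ { zero _ → λ () ; (suc j) (s≤s j<i₀) → i₀-least j j<i₀ }

  between : ∀ {q} → Subset q → Subset q → Subset q → Bool
  between []      []      []      = true
  between (z ∷ Z) (s ∷ S) (x ∷ X) = ((not z ∨ s) ∧ (not s ∨ x)) ∧ between Z S X

  between⁺ : ∀ {q} (Z S X : Subset q) → Z ⊆ₛ S → S ⊆ₛ X → T (between Z S X)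
  between⁺ []      []      []      _   _   = tt
  between⁺ (z ∷ Z) (s ∷ S) (x ∷ X) Z⊆S S⊆X =
    Equivalence.from Bool.T-∧ (Equivalence.from Bool.T-∧ (implies z s (Z⊆S zero) , implies s x (S⊆X zero)) ,
                               between⁺ Z S X (Z⊆S ∘ suc) (S⊆X ∘ suc))
    where
    implies : ∀ a b → (T a → T b) → T (not a ∨ b)
    implies true  b a⇒b = a⇒b tt
    implies false b _   = tt

  between⁻ : ∀ {q} (Z S X : Subset q) → T (between Z S X) → Z ⊆ₛ S × S ⊆ₛ X
  between⁻ [] [] [] _ = (λ ()) , (λ ())
  between⁻ (z ∷ Z) (s ∷ S) (x ∷ X) t with Equivalence.to Bool.T-∧ t
  ... | head , rest with Equivalence.to Bool.T-∧ head | between⁻ Z S X rest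
  ...   | z⇒s , s⇒x | Z⊆S , S⊆X = (λ { zero → implies z s z⇒s ; (suc i) → Z⊆S i }) ,
                                   (λ { zero → implies s x s⇒x ; (suc i) → S⊆X i })
    where
    implies : ∀ a b → T (not a ∨ b) → T a → T b
    implies true b t _ = t

  count : ∀ {q n} → Subset q → Vec (Fin n) q → Fin n → ℕ
  count S u a = size (fibre S u a)

  count-─-≢ : ∀ {q n} (S B : Subset q) (u : Vec (Fin n) q) {a₀} → B ⊆ₛ fibre S u a₀ →
              ∀ {a} → a ≢ a₀ → count S u a ≡ count (S ─ B) u a
  count-─-≢ []          []          []      B⊆ a≢a₀ = refl
  count-─-≢ (true ∷ S)  (true ∷ B)  (x ∷ u) {a₀} B⊆ {a} a≢a₀ =
    cong₂ ℕ._+_ (cong bit (dec-false (x Fin.≟ a) (λ x≡a → a≢a₀ (trans (sym x≡a) x≡a₀)))) (count-─-≢ S B u (B⊆ ∘ suc) a≢a₀)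
    where
    x≡a₀ : x ≡ a₀
    x≡a₀ = proj₂ (∈-fibre⁻ (true ∷ S) (x ∷ u) {i = zero} (B⊆ zero tt))
  count-─-≢ (false ∷ S) (true ∷ B)  (x ∷ u) B⊆ a≢a₀ = ⊥-elim (B⊆ zero tt)
  count-─-≢ (true ∷ S)  (false ∷ B) (x ∷ u) B⊆ {a} a≢a₀ =
    cong (bit (does (x Fin.≟ a)) ℕ.+_) (count-─-≢ S B u (B⊆ ∘ suc) a≢a₀)
  count-─-≢ (false ∷ S) (false ∷ B) (x ∷ u) B⊆ a≢a₀ = count-─-≢ S B u (B⊆ ∘ suc) a≢a₀

  count-─-≡ : ∀ {q n} (S B : Subset q) (u : Vec (Fin n) q) {a₀} → B ⊆ₛ fibre S u a₀ →
              count S u a₀ ≡ count (S ─ B) u a₀ ℕ.+ size B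
  count-─-≡ []          []          []      B⊆ = refl
  count-─-≡ (true ∷ S)  (true ∷ B)  (x ∷ u) {a₀} B⊆ = begin
    bit (does (x Fin.≟ a₀)) ℕ.+ count S u a₀ ≡⟨ cong₂ (λ b c → bit b ℕ.+ c) x≟a₀ (count-─-≡ S B u (B⊆ ∘ suc)) ⟩
    suc (count (S ─ B) u a₀ ℕ.+ size B)     ≡⟨ sym (ℕ.+-suc _ (size B)) ⟩
    count (S ─ B) u a₀ ℕ.+ suc (size B)     ∎
    where
    open ≡-Reasoning
    x≟a₀ : does (x Fin.≟ a₀) ≡ true
    x≟a₀ = dec-true (x Fin.≟ a₀) (proj₂ (∈-fibre⁻ (true ∷ S) (x ∷ u) {i = zero} (B⊆ zero tt)))
  count-─-≡ (false ∷ S) (true ∷ B)  (x ∷ u) B⊆ = ⊥-elim (B⊆ zero tt)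
  count-─-≡ (true ∷ S)  (false ∷ B) (x ∷ u) {a₀} B⊆ =
    trans (cong (bit (does (x Fin.≟ a₀)) ℕ.+_) (count-─-≡ S B u (B⊆ ∘ suc)))
          (sym (ℕ.+-assoc (bit (does (x Fin.≟ a₀))) (count (S ─ B) u a₀) (size B)))
  count-─-≡ (false ∷ S) (false ∷ B) (x ∷ u) B⊆ = count-─-≡ S B u (B⊆ ∘ suc)

  count-empty : ∀ {q n} (S : Subset q) (u : Vec (Fin n) q) a → (∀ i → ¬ i ∈ₛ S) → count S u a ≡ 0
  count-empty []          []      a S-empty = refl
  count-empty (true ∷ S)  (x ∷ u) a S-empty = ⊥-elim (S-empty zero tt)
  count-empty (false ∷ S) (x ∷ u) a S-empty = count-empty S u a (S-empty ∘ suc)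

module SubsetSum where

  open import Data.Bool using (true; false; if_then_else_)
  open import Data.Empty using (⊥-elim)
  import Data.Fin as Fin
  open import Data.List using (map)
  open import Data.Nat as ℕ using (ℕ; zero; suc; _≤_; _∸_; s≤s)
  import Data.Nat.Properties as ℕ
  open import Data.Nat.Combinatorics using (_C_; k>n⇒nCk≡0; nCk+nC[k+1]≡[n+1]C[k+1])
  open import Data.Rational as ℚ using (ℚ; 0ℚ; 1ℚ; _+_; _*_)
  import Data.Rational.Properties as ℚ
  open import Data.Rational.Solver using (module +-*-Solver)
  open +-*-Solver using (solve; _:+_; _:=_)
  open import Data.Unit using (tt)
  open import Data.Vec using ([]; _∷_)
  open import Function using (_∘_)
  open import Relation.Binary.PropositionalEquality
  open ≡-Reasoning

  open Fractions using (fromℕ; fromℕ-+)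
  open RangeSum
  open ListSum using (∑; sum-concatMap; sum-map; sum-0)
  open Enumeration using (bools; allSubsets)
  open Subsets

  private
    ∑ℚ = ∑ ℚ.+-*-commutativeRing

    sum-allSubsets-suc : ∀ q (F : Subset (suc q) → ℚ) →
      ∑ℚ (allSubsets (suc q)) F ≡ ∑ℚ (allSubsets q) (λ S → F (true ∷ S)) + ∑ℚ (allSubsets q) (λ S → F (false ∷ S))
    sum-allSubsets-suc q F = begin
      ∑ℚ (allSubsets (suc q)) F
        ≡⟨ sum-concatMap ℚ.+-*-commutativeRing bools (λ b → map (b ∷_) (allSubsets q)) F ⟩
      ∑ℚ (map (true ∷_) (allSubsets q)) F + (∑ℚ (map (false ∷_) (allSubsets q)) F + 0ℚ)
        ≡⟨ cong₂ _+_ (sum-map ℚ.+-*-commutativeRing (allSubsets q) (true ∷_) F)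
                     (trans (ℚ.+-identityʳ _) (sum-map ℚ.+-*-commutativeRing (allSubsets q) (false ∷_) F)) ⟩
      ∑ℚ (allSubsets q) (λ S → F (true ∷ S)) + ∑ℚ (allSubsets q) (λ S → F (false ∷ S)) ∎

    binomial-tail : ∀ q m (ψ : ℕ → ℚ) → m ≤ q →
      ∑< (suc (suc q)) (λ j → fromℕ (m C j) * ψ j) ≡ ∑< (suc q) (λ j → fromℕ (m C j) * ψ j)
    binomial-tail q m ψ m≤q = trans (cong (∑< (suc q) _ +_) last≡0) (ℚ.+-identityʳ _)
      where
      last≡0 : fromℕ (m C suc q) * ψ (suc q) ≡ 0ℚ
      last≡0 = trans (cong (λ c → fromℕ c * ψ (suc q)) (k>n⇒nCk≡0 (s≤s m≤q))) (ℚ.*-zeroˡ (ψ (suc q)))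

    binomial-pascal : ∀ q m (ψ : ℕ → ℚ) → m ≤ q →
      ∑< (suc (suc q)) (λ j → fromℕ (suc m C j) * ψ j)
        ≡ ∑< (suc q) (λ j → fromℕ (m C j) * ψ (suc j)) + ∑< (suc q) (λ j → fromℕ (m C j) * ψ j)
    binomial-pascal q m ψ m≤q = begin
      ∑< (suc (suc q)) (λ j → fromℕ (suc m C j) * ψ j)
        ≡⟨ ∑<-shift (suc q) _ ⟩
      1ℚ * ψ 0 + ∑< (suc q) (λ j → fromℕ (suc m C suc j) * ψ (suc j))
        ≡⟨ cong₂ _+_ (ℚ.*-identityˡ (ψ 0)) (∑<-cong (suc q) (λ j _ → pascal j)) ⟩
      ψ 0 + ∑< (suc q) (λ j → fromℕ (m C j) * ψ (suc j) + fromℕ (m C suc j) * ψ (suc j))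
        ≡⟨ cong (ψ 0 +_) (∑<-+ (suc q) _ _) ⟩
      ψ 0 + (A + B)
        ≡⟨ solve 3 (λ p a b → p :+ (a :+ b) := a :+ (p :+ b)) refl (ψ 0) A B ⟩
      A + (ψ 0 + B)
        ≡⟨ cong (A +_) (sym (trans (sym (binomial-tail q m ψ m≤q)) (trans (∑<-shift (suc q) _)
                                    (cong (_+ B) (ℚ.*-identityˡ (ψ 0)))))) ⟩
      A + ∑< (suc q) (λ j → fromℕ (m C j) * ψ j) ∎
      where
      A B : ℚ
      A = ∑< (suc q) (λ j → fromℕ (m C j) * ψ (suc j))
      B = ∑< (suc q) (λ j → fromℕ (m C suc j) * ψ (suc j))
      pascal : ∀ j → fromℕ (suc m C suc j) * ψ (suc j) ≡ fromℕ (m C j) * ψ (suc j) + fromℕ (m C suc j) * ψ (suc j)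
      pascal j = trans (cong (λ c → fromℕ c * ψ (suc j)) (sym (nCk+nC[k+1]≡[n+1]C[k+1] m j)))
                       (trans (cong (_* ψ (suc j)) (fromℕ-+ (m C j) (m C suc j))) (ℚ.*-distribʳ-+ (ψ (suc j)) (fromℕ (m C j)) (fromℕ (m C suc j))))

  -- Z ⊆ S ⊆ X with |S| = j + |Z| leaves (|X| - |Z| choose j) choices of S.
  sum-between : ∀ {q} (X Z : Subset q) (φ : ℕ → ℚ) → Z ⊆ₛ X →
    ∑ℚ (allSubsets q) (λ S → if between Z S X then φ (size S) else 0ℚ)
      ≡ ∑< (suc q) (λ j → fromℕ ((size X ∸ size Z) C j) * φ (j ℕ.+ size Z))
  sum-between [] [] φ _ = trans (ℚ.+-identityʳ (φ 0)) (trans (sym (ℚ.*-identityˡ (φ 0))) (sym (ℚ.+-identityˡ _)))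
  sum-between {suc q} (true ∷ X) (false ∷ Z) φ Z⊆X = begin
    ∑ℚ (allSubsets (suc q)) (λ S → if between (false ∷ Z) S (true ∷ X) then φ (size S) else 0ℚ)
      ≡⟨ sum-allSubsets-suc q (λ S → if between (false ∷ Z) S (true ∷ X) then φ (size S) else 0ℚ) ⟩
    ∑ℚ (allSubsets q) (λ S → if between Z S X then φ (suc (size S)) else 0ℚ)
      + ∑ℚ (allSubsets q) (λ S → if between Z S X then φ (size S) else 0ℚ)
      ≡⟨ cong₂ _+_ (sum-between X Z (φ ∘ suc) (Z⊆X ∘ Fin.suc)) (sum-between X Z φ (Z⊆X ∘ Fin.suc)) ⟩
    ∑< (suc q) (λ j → fromℕ (m C j) * ψ (suc j)) + ∑< (suc q) (λ j → fromℕ (m C j) * ψ j)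
      ≡⟨ sym (binomial-pascal q m ψ m≤q) ⟩
    ∑< (suc (suc q)) (λ j → fromℕ (suc m C j) * ψ j)
      ≡⟨ cong (λ w → ∑< (suc (suc q)) (λ j → fromℕ (w C j) * ψ j)) (sym (ℕ.+-∸-assoc 1 (size-mono Z X (Z⊆X ∘ Fin.suc)))) ⟩
    ∑< (suc (suc q)) (λ j → fromℕ ((suc (size X) ∸ size Z) C j) * ψ j) ∎
    where
    m : ℕ
    m = size X ∸ size Z
    ψ : ℕ → ℚ
    ψ j = φ (j ℕ.+ size Z)
    m≤q : m ≤ q
    m≤q = ℕ.≤-trans (ℕ.m∸n≤m (size X) (size Z)) (size≤ X)
  sum-between {suc q} (false ∷ X) (false ∷ Z) φ Z⊆X = begin
    ∑ℚ (allSubsets (suc q)) (λ S → if between (false ∷ Z) S (false ∷ X) then φ (size S) else 0ℚ)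
      ≡⟨ sum-allSubsets-suc q (λ S → if between (false ∷ Z) S (false ∷ X) then φ (size S) else 0ℚ) ⟩
    ∑ℚ (allSubsets q) (λ _ → 0ℚ) + ∑ℚ (allSubsets q) (λ S → if between Z S X then φ (size S) else 0ℚ)
      ≡⟨ cong₂ _+_ (sum-0 ℚ.+-*-commutativeRing (allSubsets q)) (sum-between X Z φ (Z⊆X ∘ Fin.suc)) ⟩
    0ℚ + ∑< (suc q) f ≡⟨ ℚ.+-identityˡ _ ⟩
    ∑< (suc q) f
      ≡⟨ sym (binomial-tail q (size X ∸ size Z) (λ j → φ (j ℕ.+ size Z)) (ℕ.≤-trans (ℕ.m∸n≤m (size X) (size Z)) (size≤ X))) ⟩
    ∑< (suc (suc q)) f ∎
    where
    f : ℕ → ℚ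
    f j = fromℕ ((size X ∸ size Z) C j) * φ (j ℕ.+ size Z)
  sum-between {suc q} (true ∷ X) (true ∷ Z) φ Z⊆X = begin
    ∑ℚ (allSubsets (suc q)) (λ S → if between (true ∷ Z) S (true ∷ X) then φ (size S) else 0ℚ)
      ≡⟨ sum-allSubsets-suc q (λ S → if between (true ∷ Z) S (true ∷ X) then φ (size S) else 0ℚ) ⟩
    ∑ℚ (allSubsets q) (λ S → if between Z S X then φ (suc (size S)) else 0ℚ) + ∑ℚ (allSubsets q) (λ _ → 0ℚ)
      ≡⟨ cong₂ _+_ (sum-between X Z (φ ∘ suc) (Z⊆X ∘ Fin.suc)) (sum-0 ℚ.+-*-commutativeRing (allSubsets q)) ⟩
    ∑< (suc q) (λ j → fromℕ ((size X ∸ size Z) C j) * φ (suc (j ℕ.+ size Z))) + 0ℚ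
      ≡⟨ ℚ.+-identityʳ _ ⟩
    ∑< (suc q) (λ j → fromℕ ((size X ∸ size Z) C j) * φ (suc (j ℕ.+ size Z)))
      ≡⟨ ∑<-cong (suc q) (λ j _ → cong (λ w → fromℕ ((size X ∸ size Z) C j) * φ w) (sym (ℕ.+-suc j (size Z)))) ⟩
    ∑< (suc q) f
      ≡⟨ sym (binomial-tail q (size X ∸ size Z) (λ j → φ (j ℕ.+ suc (size Z))) (ℕ.≤-trans (ℕ.m∸n≤m (size X) (size Z)) (size≤ X))) ⟩
    ∑< (suc (suc q)) f ∎
    where
    f : ℕ → ℚ
    f j = fromℕ ((size X ∸ size Z) C j) * φ (j ℕ.+ suc (size Z))
  sum-between {suc q} (false ∷ X) (true ∷ Z) φ Z⊆X = ⊥-elim (Z⊆X Fin.zero tt)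

module SubsetPartitions where

  open import Data.Bool as Bool using (Bool; true; false; T; if_then_else_; _∧_; _∨_; not)
  import Data.Bool.Properties as Bool
  open import Data.Empty using (⊥-elim)
  open import Data.Fin as Fin using (Fin; toℕ)
  open import Data.Fin.Properties using (all?; toℕ-injective)
  open import Data.List using (allFin)
  open import Data.List.Membership.Propositional.Properties using (∈-allFin)
  open import Data.List.Relation.Unary.Unique.Propositional.Properties using (allFin⁺)
  open import Data.Nat as ℕ using (ℕ; _<_)
  import Data.Nat.Properties as ℕ
  open import Data.Product using (_×_; _,_; proj₁; proj₂)
  open import Data.Rational using (ℚ; 1ℚ; _*_)
  import Data.Rational.Properties as ℚ
  open import Data.Sum using (_⊎_; inj₁; inj₂)
  open import Data.Unit using (tt)
  open import Data.Vec using (Vec; lookup; tabulate)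
  import Data.Vec.Properties as Vec
  open import Function using (_∘_)
  open import Function.Bundles using (Equivalence)
  open import Relation.Binary.Definitions using (tri<; tri≈; tri>)
  open import Relation.Binary.PropositionalEquality
  open import Relation.Nullary using (Dec; yes; no; does; ¬_)
  open import Relation.Nullary.Decidable using (_×-dec_; _→-dec_; map′; dec-true; dec-false)

  open import Defs
  open Prelude using (vec-ext; ¬T⇒≡false; does-cong)
  open ListProduct
  open Subsets

  private
    T-∨⁻ : ∀ {x y} → T (x ∨ y) → T x ⊎ T y
    T-∨⁻ = Equivalence.to Bool.T-∨

    T-∨⁺ˡ : ∀ {x y} → T x → T (x ∨ y)
    T-∨⁺ˡ t = Equivalence.from Bool.T-∨ (inj₁ t)

    T-∨⁺ʳ : ∀ {x y} → T y → T (x ∨ y)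
    T-∨⁺ʳ t = Equivalence.from Bool.T-∨ (inj₂ t)

    T-∧⁻ : ∀ {x y} → T (x ∧ y) → T x × T y
    T-∧⁻ = Equivalence.to Bool.T-∧

    T-∧⁺ : ∀ {x y} → T x → T y → T (x ∧ y)
    T-∧⁺ a b = Equivalence.from Bool.T-∧ (a , b)

    T-not⁻ : ∀ {x} → T (not x) → ¬ T x
    T-not⁻ {false} _ ()

    T-not⁺ : ∀ {x} → ¬ T x → T (not x)
    T-not⁺ {false} _  = tt
    T-not⁺ {true}  ¬t = ¬t tt

  rel-ext : ∀ {q} (M N : Relation q) → (∀ i j → rel M i j ≡ rel N i j) → M ≡ N
  rel-ext M N M≗N = vec-ext M N (λ i → vec-ext (lookup M i) (lookup N i) (M≗N i))

  relation : ∀ {q} → (Fin q → Fin q → Bool) → Relation q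
  relation f = tabulate (λ i → tabulate (f i))

  rel-relation : ∀ {q} (f : Fin q → Fin q → Bool) i j → rel (relation f) i j ≡ f i j
  rel-relation f i j = trans (cong (λ v → lookup v j) (Vec.lookup∘tabulate (λ i → tabulate (f i)) i))
                             (Vec.lookup∘tabulate (f i) j)

  record IsEquivalenceOn {q} (S : Subset q) (M : Relation q) : Set where
    field
      support    : ∀ i j → T (rel M i j) → i ∈ₛ S
      reflexive  : ∀ i → i ∈ₛ S → T (rel M i i)
      symmetric  : ∀ i j → T (rel M i j) → T (rel M j i)
      transitive : ∀ i j k → T (rel M i j) → T (rel M j k) → T (rel M i k)

  isEquivalenceOn? : ∀ {q} (S : Subset q) (M : Relation q) → Dec (IsEquivalenceOn S M)
  isEquivalenceOn? S M = map′ (λ (s , r , y , t) → record { support = s ; reflexive = r ; symmetric = y ; transitive = t })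
    (λ e → let open IsEquivalenceOn e in support , reflexive , symmetric , transitive)
    ((all? λ i → all? λ j → T? (rel M i j) →-dec T? (lookup S i)) ×-dec
    ((all? λ i → T? (lookup S i) →-dec T? (rel M i i)) ×-dec
    ((all? λ i → all? λ j → T? (rel M i j) →-dec T? (rel M j i)) ×-dec
     (all? λ i → all? λ j → all? λ k → T? (rel M i j) →-dec (T? (rel M j k) →-dec T? (rel M i k))))))

  Admissible : ∀ {q n} → Vec (Fin n) q → Subset q → Relation q → Set
  Admissible u S M = IsEquivalenceOn S M × u ≺ M

  admissible? : ∀ {q n} (u : Vec (Fin n) q) (S : Subset q) (M : Relation q) → Dec (Admissible u S M)
  admissible? u S M = isEquivalenceOn? S M ×-dec (u ≺? M)

  glue : ∀ {q} → Subset q → Relation q → Relation q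
  glue B M = relation (λ i j → rel M i j ∨ (lookup B i ∧ lookup B j))

  restrict : ∀ {q} → Subset q → Relation q → Relation q
  restrict B M = relation (λ i j → rel M i j ∧ (not (lookup B i) ∧ not (lookup B j)))

  -- C(|B|)/|B|! for each block B of M, attached to the least element of B.
  factor : ∀ {q} → Subset q → Relation q → Fin q → ℚ
  factor S M i = if lookup S i then (if does (isLeastInBlock? M i) then carlitzOverFact (blockSize M i) else 1ℚ) else 1ℚ

  weightOn : ∀ {q} → Subset q → Relation q → ℚ
  weightOn {q} S M = ∏ (allFin q) (factor S M)

  factor-∈ : ∀ {q} (S : Subset q) M {i} → i ∈ₛ S →
             factor S M i ≡ (if does (isLeastInBlock? M i) then carlitzOverFact (blockSize M i) else 1ℚ)
  factor-∈ S M {i} i∈S =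
    cong (λ s → if s then (if does (isLeastInBlock? M i) then carlitzOverFact (blockSize M i) else 1ℚ) else 1ℚ)
         (Equivalence.to Bool.T-≡ i∈S)

  factor-least : ∀ {q} (S : Subset q) M {i} → i ∈ₛ S → IsLeastInBlock M i → factor S M i ≡ carlitzOverFact (blockSize M i)
  factor-least S M {i} i∈S least =
    trans (factor-∈ S M i∈S) (cong (λ b → if b then carlitzOverFact (blockSize M i) else 1ℚ) (dec-true (isLeastInBlock? M i) least))

  factor-notLeast : ∀ {q} (S : Subset q) M {i} → ¬ IsLeastInBlock M i → factor S M i ≡ 1ℚ
  factor-notLeast S M {i} ¬least with lookup S i
  ... | true  = cong (λ b → if b then carlitzOverFact (blockSize M i) else 1ℚ) (dec-false (isLeastInBlock? M i) ¬least)
  ... | false = refl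

  factor-∉ : ∀ {q} (S : Subset q) M {i} → lookup S i ≡ false → factor S M i ≡ 1ℚ
  factor-∉ S M {i} i∉S =
    cong (λ s → if s then (if does (isLeastInBlock? M i) then carlitzOverFact (blockSize M i) else 1ℚ) else 1ℚ) i∉S

  blockSize≡size : ∀ {q} (M : Relation q) i → blockSize M i ≡ size (lookup M i)
  blockSize≡size M i = size-count (lookup M i)

  -- Removing the block of the least element i₀ of S: admissible partitions of S correspond
  -- to pairs (block B ∋ i₀ inside the fibre of u(i₀), admissible partition of S ─ B).
  module BlockDecomposition {q n} (u : Vec (Fin n) q) (S : Subset q) (i₀ : Fin q) (i₀∈S : i₀ ∈ₛ S)
                            (i₀-least : ∀ j → toℕ j < toℕ i₀ → ¬ j ∈ₛ S) where

    a₀ : Fin n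
    a₀ = lookup u i₀

    IsBlock : Subset q → Set
    IsBlock B = i₀ ∈ₛ B × B ⊆ₛ fibre S u a₀

    module _ (M : Relation q) (admissible : Admissible u S M) where
      open IsEquivalenceOn (proj₁ admissible)

      private
        u≺M : u ≺ M
        u≺M = proj₂ admissible
        R : Subset q
        R = lookup M i₀

      row-isBlock : IsBlock R
      row-isBlock = reflexive i₀ i₀∈S ,
                    λ i i₀~i → ∈-fibre⁺ S u (support i i₀ (symmetric i₀ i i₀~i)) (sym (u≺M i₀ i i₀~i))

      private
        restrict⁻ : ∀ {i j} → T (rel (restrict R M) i j) → T (rel M i j) × ¬ i ∈ₛ R × ¬ j ∈ₛ R
        restrict⁻ {i} {j} t with T-∧⁻ (subst T (rel-relation _ i j) t)
        ... | i~j , rest with T-∧⁻ rest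
        ...   | i∉R , j∉R = i~j , T-not⁻ i∉R , T-not⁻ j∉R

        restrict⁺ : ∀ {i j} → T (rel M i j) → ¬ i ∈ₛ R → ¬ j ∈ₛ R → T (rel (restrict R M) i j)
        restrict⁺ {i} {j} i~j i∉R j∉R = subst T (sym (rel-relation _ i j)) (T-∧⁺ i~j (T-∧⁺ (T-not⁺ i∉R) (T-not⁺ j∉R)))

      restrict-admissible : Admissible u (S ─ R) (restrict R M)
      restrict-admissible = record
        { support    = λ i j t → let (i~j , i∉R , _) = restrict⁻ t in ∈-─⁺ S R (support i j i~j) i∉R
        ; reflexive  = λ i i∈ → let (i∈S , i∉R) = ∈-─⁻ S R i∈ in restrict⁺ (reflexive i i∈S) i∉R i∉R
        ; symmetric  = λ i j t → let (i~j , i∉R , j∉R) = restrict⁻ t in restrict⁺ (symmetric i j i~j) j∉R i∉R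
        ; transitive = λ i j k t₁ t₂ → let (i~j , i∉R , _) = restrict⁻ t₁ ; (j~k , _ , k∉R) = restrict⁻ t₂
                                       in restrict⁺ (transitive i j k i~j j~k) i∉R k∉R
        } , λ i j t → u≺M i j (proj₁ (restrict⁻ t))

      glue-restrict : glue R (restrict R M) ≡ M
      glue-restrict = rel-ext (glue R (restrict R M)) M λ i j →
        trans (rel-relation _ i j) (trans (cong (_∨ (lookup R i ∧ lookup R j)) (rel-relation _ i j))
          (reassemble (lookup R i) (lookup R j) (rel M i j)
            (λ i₀~i i₀~j → transitive i i₀ j (symmetric i₀ i i₀~i) i₀~j)
            (λ i₀~i i~j → transitive i₀ i j i₀~i i~j)
            (λ i₀~j i~j → transitive i₀ j i i₀~j (symmetric i j i~j))))
        where
        -- a = (i₀ ~ i), b = (i₀ ~ j), c = (i ~ j): transitivity forbids exactly two of them to hold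
        reassemble : ∀ a b c → (T a → T b → T c) → (T a → T c → T b) → (T b → T c → T a) →
                     (c ∧ (not a ∧ not b)) ∨ (a ∧ b) ≡ c
        reassemble true  true  true  _ _ _ = refl
        reassemble true  true  false f _ _ = ⊥-elim (f tt tt)
        reassemble true  false true  _ g _ = ⊥-elim (g tt tt)
        reassemble true  false false _ _ _ = refl
        reassemble false true  true  _ _ h = ⊥-elim (h tt tt)
        reassemble false true  false _ _ _ = refl
        reassemble false false true  _ _ _ = refl
        reassemble false false false _ _ _ = refl

    module _ (B : Subset q) (block : IsBlock B) (M′ : Relation q) (admissible′ : Admissible u (S ─ B) M′) where
      open IsEquivalenceOn (proj₁ admissible′)

      private
        i₀∈B : i₀ ∈ₛ B
        i₀∈B = proj₁ block
        B⊆fibre : B ⊆ₛ fibre S u a₀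
        B⊆fibre = proj₂ block
        u≺M′ : u ≺ M′
        u≺M′ = proj₂ admissible′
        G : Relation q
        G = glue B M′

        B⊆S : B ⊆ₛ S
        B⊆S i i∈B = proj₁ (∈-fibre⁻ S u (B⊆fibre i i∈B))

        u≡a₀ : ∀ {i} → i ∈ₛ B → lookup u i ≡ a₀
        u≡a₀ {i} i∈B = proj₂ (∈-fibre⁻ S u (B⊆fibre i i∈B))

        glue⁻ : ∀ {i j} → T (rel G i j) → T (rel M′ i j) ⊎ (i ∈ₛ B × j ∈ₛ B)
        glue⁻ {i} {j} t with T-∨⁻ (subst T (rel-relation _ i j) t)
        ... | inj₁ i~j = inj₁ i~j
        ... | inj₂ ij∈B = inj₂ (T-∧⁻ ij∈B)

        glue⁺ˡ : ∀ {i j} → T (rel M′ i j) → T (rel G i j)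
        glue⁺ˡ {i} {j} i~j = subst T (sym (rel-relation _ i j)) (T-∨⁺ˡ i~j)

        glue⁺ʳ : ∀ {i j} → i ∈ₛ B → j ∈ₛ B → T (rel G i j)
        glue⁺ʳ {i} {j} i∈B j∈B = subst T (sym (rel-relation _ i j)) (T-∨⁺ʳ (T-∧⁺ i∈B j∈B))

        ∉Bˡ : ∀ {i j} → T (rel M′ i j) → ¬ i ∈ₛ B
        ∉Bˡ {i} {j} i~j = proj₂ (∈-─⁻ S B (support i j i~j))

        ∉Bʳ : ∀ {i j} → T (rel M′ i j) → ¬ j ∈ₛ B
        ∉Bʳ {i} {j} i~j = ∉Bˡ (symmetric i j i~j)

      glue-admissible : Admissible u S G
      glue-admissible = record { support = support′ ; reflexive = reflexive′ ; symmetric = symmetric′ ; transitive = transitive′ } ,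
                        const
        where
        support′ : ∀ i j → T (rel G i j) → i ∈ₛ S
        support′ i j t with glue⁻ t
        ... | inj₁ i~j       = proj₁ (∈-─⁻ S B (support i j i~j))
        ... | inj₂ (i∈B , _) = B⊆S i i∈B
        reflexive′ : ∀ i → i ∈ₛ S → T (rel G i i)
        reflexive′ i i∈S with T? (lookup B i)
        ... | yes i∈B = glue⁺ʳ i∈B i∈B
        ... | no i∉B  = glue⁺ˡ (reflexive i (∈-─⁺ S B i∈S i∉B))
        symmetric′ : ∀ i j → T (rel G i j) → T (rel G j i)
        symmetric′ i j t with glue⁻ t
        ... | inj₁ i~j         = glue⁺ˡ (symmetric i j i~j)
        ... | inj₂ (i∈B , j∈B) = glue⁺ʳ j∈B i∈B
        transitive′ : ∀ i j k → T (rel G i j) → T (rel G j k) → T (rel G i k)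
        transitive′ i j k t₁ t₂ with glue⁻ t₁ | glue⁻ t₂
        ... | inj₁ i~j         | inj₁ j~k         = glue⁺ˡ (transitive i j k i~j j~k)
        ... | inj₁ i~j         | inj₂ (j∈B , _)   = ⊥-elim (∉Bʳ i~j j∈B)
        ... | inj₂ (_ , j∈B)   | inj₁ j~k         = ⊥-elim (∉Bˡ j~k j∈B)
        ... | inj₂ (i∈B , _)   | inj₂ (_ , k∈B)   = glue⁺ʳ i∈B k∈B
        const : u ≺ G
        const i j t with glue⁻ t
        ... | inj₁ i~j         = u≺M′ i j i~j
        ... | inj₂ (i∈B , j∈B) = trans (u≡a₀ i∈B) (sym (u≡a₀ j∈B))

      row-glue : lookup G i₀ ≡ B
      row-glue = vec-ext (lookup G i₀) B λ j →
        trans (rel-relation _ i₀ j) (cong₂ (λ x y → x ∨ (y ∧ lookup B j)) (¬T⇒≡false (λ t → ∉Bˡ t i₀∈B))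
                                          (Equivalence.to Bool.T-≡ i₀∈B))

      restrict-glue : restrict B G ≡ M′
      restrict-glue = rel-ext (restrict B G) M′ λ i j →
        trans (rel-relation _ i j) (trans (cong (_∧ (not (lookup B i) ∧ not (lookup B j))) (rel-relation _ i j))
          (separate (rel M′ i j) (lookup B i) (lookup B j) ∉Bˡ ∉Bʳ))
        where
        separate : ∀ c a b → (T c → ¬ T a) → (T c → ¬ T b) → (c ∨ (a ∧ b)) ∧ (not a ∧ not b) ≡ c
        separate true  true  b     f g = ⊥-elim (f tt tt)
        separate true  false true  f g = ⊥-elim (g tt tt)
        separate true  false false f g = refl
        separate false true  true  f g = refl
        separate false true  false f g = refl
        separate false false b     f g = refl

      private
        row≡ : ∀ {i} → ¬ i ∈ₛ B → ∀ j → rel G i j ≡ rel M′ i j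
        row≡ {i} i∉B j = trans (rel-relation _ i j)
          (trans (cong (λ x → rel M′ i j ∨ (x ∧ lookup B j)) (¬T⇒≡false i∉B)) (Bool.∨-identityʳ _))

        column≡ : ∀ {i} → ¬ i ∈ₛ B → ∀ j → rel G j i ≡ rel M′ j i
        column≡ {i} i∉B j = trans (rel-relation _ j i)
          (trans (cong (λ x → rel M′ j i ∨ (lookup B j ∧ x)) (¬T⇒≡false i∉B))
            (trans (cong (rel M′ j i ∨_) (Bool.∧-zeroʳ (lookup B j))) (Bool.∨-identityʳ _)))

        leaves-S─B : ∀ {i} → i ∈ₛ B → lookup (S ─ B) i ≡ false
        leaves-S─B {i} i∈B = trans (lookup-─ S B i)
          (trans (cong (λ b → lookup S i ∧ not b) (Equivalence.to Bool.T-≡ i∈B)) (Bool.∧-zeroʳ (lookup S i)))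

        factor-i₀ : factor S G i₀ ≡ carlitzOverFact (size B)
        factor-i₀ = trans (factor-least S G i₀∈S (λ j j<i₀ j~i₀ → i₀-least j j<i₀ (support-G j i₀ j~i₀)))
                          (cong carlitzOverFact (trans (blockSize≡size G i₀) (cong size row-glue)))
          where
          support-G : ∀ i j → T (rel G i j) → i ∈ₛ S
          support-G = IsEquivalenceOn.support (proj₁ glue-admissible)

        i₀<i : ∀ {i} → i ≢ i₀ → i ∈ₛ S → toℕ i₀ < toℕ i
        i₀<i {i} i≢i₀ i∈S with ℕ.<-cmp (toℕ i₀) (toℕ i)
        ... | tri< i₀<i _ _ = i₀<i
        ... | tri≈ _ i₀≡i _ = ⊥-elim (i≢i₀ (sym (toℕ-injective i₀≡i)))
        ... | tri> _ _ i<i₀ = ⊥-elim (i₀-least i i<i₀ i∈S)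

        factor-in-B : ∀ {i} → i ≢ i₀ → i ∈ₛ B → factor S G i ≡ factor (S ─ B) M′ i
        factor-in-B {i} i≢i₀ i∈B =
          trans (factor-notLeast S G (λ least → least i₀ (i₀<i i≢i₀ (B⊆S i i∈B)) (glue⁺ʳ i₀∈B i∈B)))
                (sym (factor-∉ (S ─ B) M′ (leaves-S─B i∈B)))

        factor-outside-B : ∀ {i} → ¬ i ∈ₛ B → factor S G i ≡ factor (S ─ B) M′ i
        factor-outside-B {i} i∉B = cong₂ (λ s x → if s then x else 1ℚ) (sym S─B≡S)
          (cong₂ (λ b k → if b then carlitzOverFact k else 1ℚ) least≡ (trans (blockSize≡size G i)
            (trans (cong size (vec-ext (lookup G i) (lookup M′ i) (row≡ i∉B))) (sym (blockSize≡size M′ i)))))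
          where
          S─B≡S : lookup (S ─ B) i ≡ lookup S i
          S─B≡S = trans (lookup-─ S B i) (trans (cong (λ b → lookup S i ∧ not b) (¬T⇒≡false i∉B)) (Bool.∧-identityʳ _))
          least≡ : does (isLeastInBlock? G i) ≡ does (isLeastInBlock? M′ i)
          least≡ = does-cong (isLeastInBlock? G i) (isLeastInBlock? M′ i)
            (λ least j j<i t → least j j<i (subst T (sym (column≡ i∉B j)) t))
            (λ least j j<i t → least j j<i (subst T (column≡ i∉B j) t))

        factor-away : ∀ {i} → i ≢ i₀ → Dec (i ∈ₛ B) → factor S G i ≡ factor (S ─ B) M′ i
        factor-away i≢i₀ (yes i∈B) = factor-in-B i≢i₀ i∈B
        factor-away _    (no i∉B)  = factor-outside-B i∉B

      weight-glue : weightOn S G ≡ carlitzOverFact (size B) * weightOn (S ─ B) M′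
      weight-glue = ∏-update Fin._≟_ (allFin q) (factor S G) (factor (S ─ B) M′) (carlitzOverFact (size B))
        (allFin⁺ q) (∈-allFin i₀)
        (trans factor-i₀ (sym (trans (cong (carlitzOverFact (size B) *_) (factor-∉ (S ─ B) M′ (leaves-S─B i₀∈B)))
                                     (ℚ.*-identityʳ _))))
        (λ i i≢i₀ → factor-away i≢i₀ (T? (lookup B i)))

module PartitionSum where

  open import Algebra.Bundles using (CommutativeRing)
  open import Level using (0ℓ)
  open import Data.Bool as Bool using (Bool; false; T; T?; if_then_else_)
  open import Data.Empty using (⊥; ⊥-elim)
  open import Data.Fin as Fin using (Fin; toℕ)
  open import Data.Fin.Properties using (all?; any?)
  open import Data.List using (List; []; _∷_; allFin; filter; map)
  open import Data.List.Membership.Propositional using (_∈_)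
  open import Data.List.Membership.Propositional.Properties using (∈-filter⁺; ∈-filter⁻; ∈-map⁺; ∈-map⁻; ∈-allFin)
  open import Data.List.Relation.Unary.All as All using ()
  open import Data.List.Relation.Unary.AllPairs using ([]; _∷_)
  open import Data.List.Relation.Unary.Any using (here)
  open import Data.List.Relation.Unary.Unique.Propositional using (Unique)
  open import Data.List.Relation.Binary.Permutation.Propositional using (_↭_)
  import Data.List.Relation.Unary.Unique.Propositional.Properties as Unique
  open import Data.Nat as ℕ using (ℕ; suc; _≤_; _<_; _∸_; _!)
  import Data.Nat.Properties as ℕ
  open import Data.Nat.Combinatorics using (_C_; k>n⇒nCk≡0)
  import Data.Nat.Induction as ℕ
  open import Induction.WellFounded using (Acc; acc)
  import Relation.Binary.Construct.On as On
  open import Data.Product using (_×_; _,_; proj₁; proj₂)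
  open import Data.Rational as ℚ using (ℚ; 0ℚ; 1ℚ; _*_)
  import Data.Rational.Properties as ℚ
  open import Data.Rational.Solver using (module +-*-Solver)
  open +-*-Solver using (solve; _:*_; _:=_)
  open import Data.Vec using (Vec; lookup)
  import Data.Vec.Properties as Vec
  open import Relation.Binary.PropositionalEquality
  open import Relation.Nullary using (Dec; yes; no; does; ¬_)
  open import Relation.Nullary.Decidable using (_×-dec_; _→-dec_)

  open import Defs using (Relation; rel; carlitzOverFact; Carlitz)
  open Fractions using (fromℕ; fromℕ-*; 1/n*n≡1)
  open RangeSum using (∑<; ∑<-cong; ∑<-vanishing)
  open CarlitzRecurrence using (carlitz-recurrence)
  open ListSum
  open ListProduct
  open Enumeration
  open Subsets
  open SubsetSum using (sum-between)
  open SubsetPartitions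
  open Prelude using (↭-fromUnique; unique-map⁺-on; ¬T⇒≡false; does-reflects)
  open Binomial using (nCk*k!*[n∸k]!≡n!)

  private
    ℚ-ring : CommutativeRing 0ℓ 0ℓ
    ℚ-ring = ℚ.+-*-commutativeRing

    ∑ℚ : ∀ {a} {A : Set a} → List A → (A → ℚ) → ℚ
    ∑ℚ = ∑ ℚ-ring

  module _ {q n} (u : Vec (Fin n) q) where

    partitionSum : Subset q → ℚ
    partitionSum S = ∑ℚ (filter (admissible? u S) (allRelations q)) (weightOn S)

    factorials : Subset q → ℚ
    factorials S = ∏ (allFin n) (λ a → fromℕ (count S u a !))

    module Peel (S : Subset q) (i₀ : Fin q) (i₀∈S : i₀ ∈ₛ S) (i₀-least : ∀ j → toℕ j < toℕ i₀ → ¬ j ∈ₛ S) where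
      open BlockDecomposition u S i₀ i₀∈S i₀-least

      isBlock? : ∀ B → Dec (IsBlock B)
      isBlock? B = T? (lookup B i₀) ×-dec all? (λ i → T? (lookup B i) →-dec T? (lookup (fibre S u a₀) i))

      private
        L : List (Relation q)
        L = filter (admissible? u S) (allRelations q)

        _≟ₛ_ : (x y : Subset q) → Dec (x ≡ y)
        _≟ₛ_ = Vec.≡-dec Bool._≟_

        withRow : Subset q → List (Relation q)
        withRow B = filter (λ M → lookup M i₀ ≟ₛ B) L

        admissible⁻ : ∀ {S′ M} → M ∈ filter (admissible? u S′) (allRelations q) → Admissible u S′ M
        admissible⁻ {S′} M∈ = proj₂ (∈-filter⁻ (admissible? u S′) {xs = allRelations q} M∈)

        withRow-non-block : ∀ B → ¬ IsBlock B → ∑ℚ (withRow B) (weightOn S) ≡ 0ℚ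
        withRow-non-block B ¬block = trans (sum-filter ℚ-ring (λ M → lookup M i₀ ≟ₛ B) L (weightOn S))
          (trans (sum-cong-∈ ℚ-ring L (λ {M} M∈ → vanish M M∈ (lookup M i₀ ≟ₛ B))) (sum-0 ℚ-ring L))
          where
          vanish : ∀ M → M ∈ L → (row? : Dec (lookup M i₀ ≡ B)) → (if does row? then weightOn S M else 0ℚ) ≡ 0ℚ
          vanish M M∈ (yes refl) = ⊥-elim (¬block (row-isBlock M (admissible⁻ M∈)))
          vanish M M∈ (no _)     = refl

        module _ (B : Subset q) (block : IsBlock B) where
          L′ : List (Relation q)
          L′ = filter (admissible? u (S ─ B)) (allRelations q)

          withRow↭glued : withRow B ↭ map (glue B) L′
          withRow↭glued = ↭-fromUnique
            (Unique.filter⁺ _ (Unique.filter⁺ _ (allRelations-unique q)))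
            (unique-map⁺-on (glue B) L′ (Unique.filter⁺ _ (allRelations-unique q)) λ x∈ y∈ e →
              trans (sym (restrict-glue B block _ (admissible⁻ x∈))) (trans (cong (restrict B) e) (restrict-glue B block _ (admissible⁻ y∈))))
            to from
            where
            to : ∀ {M} → M ∈ withRow B → M ∈ map (glue B) L′
            to {M} M∈ with ∈-filter⁻ (λ M → lookup M i₀ ≟ₛ B) {xs = L} M∈
            ... | M∈L , refl = subst (_∈ map (glue (lookup M i₀)) L′) (glue-restrict M (admissible⁻ M∈L))
              (∈-map⁺ (glue (lookup M i₀)) (∈-filter⁺ (admissible? u (S ─ lookup M i₀)) (allRelations-complete _)
                (restrict-admissible M (admissible⁻ M∈L))))
            from : ∀ {M} → M ∈ map (glue B) L′ → M ∈ withRow B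
            from M∈ with ∈-map⁻ (glue B) M∈
            ... | M′ , M′∈ , refl = ∈-filter⁺ (λ M → lookup M i₀ ≟ₛ B)
              (∈-filter⁺ (admissible? u S) (allRelations-complete _) (glue-admissible B block M′ (admissible⁻ M′∈)))
              (row-glue B block M′ (admissible⁻ M′∈))

          withRow-block : ∑ℚ (withRow B) (weightOn S) ≡ carlitzOverFact (size B) * partitionSum (S ─ B)
          withRow-block = begin
            ∑ℚ (withRow B) (weightOn S)              ≡⟨ sum-↭ ℚ-ring (weightOn S) withRow↭glued ⟩
            ∑ℚ (map (glue B) L′) (weightOn S)        ≡⟨ sum-map ℚ-ring L′ (glue B) (weightOn S) ⟩
            ∑ℚ L′ (λ M′ → weightOn S (glue B M′))
              ≡⟨ sum-cong-∈ ℚ-ring L′ {λ M′ → weightOn S (glue B M′)}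
                   (λ {M′} M′∈ → weight-glue B block M′ (admissible⁻ M′∈)) ⟩
            ∑ℚ L′ (λ M′ → carlitzOverFact (size B) * weightOn (S ─ B) M′)
              ≡⟨ sym (sum-*ˡ ℚ-ring L′ (carlitzOverFact (size B)) (weightOn (S ─ B))) ⟩
            carlitzOverFact (size B) * partitionSum (S ─ B) ∎
            where open ≡-Reasoning

        withRow-sum : ∀ B (block? : Dec (IsBlock B)) →
          ∑ℚ (withRow B) (weightOn S) ≡ (if does block? then carlitzOverFact (size B) * partitionSum (S ─ B) else 0ℚ)
        withRow-sum B (yes block) = withRow-block B block
        withRow-sum B (no ¬block) = withRow-non-block B ¬block

      peeled : Subset q → ℚ
      peeled B = if does (isBlock? B) then carlitzOverFact (size B) * partitionSum (S ─ B) else 0ℚ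

      -- Sort the admissible partitions of S by the block of i₀.
      partitionSum-peel : partitionSum S ≡ ∑ℚ (allSubsets q) peeled
      partitionSum-peel = begin
        ∑ℚ L (weightOn S)
          ≡⟨ sum-cong ℚ-ring L (λ M → sym (sum-δ ℚ-ring _≟ₛ_ (allSubsets q) (weightOn S M)
                                                 (allSubsets-unique q) (allSubsets-complete (lookup M i₀)))) ⟩
        ∑ℚ L (λ M → ∑ℚ (allSubsets q) (δ ℚ-ring _≟ₛ_ (lookup M i₀) (weightOn S M)))
          ≡⟨ sum-swap ℚ-ring L (allSubsets q) (λ M → δ ℚ-ring _≟ₛ_ (lookup M i₀) (weightOn S M)) ⟩
        ∑ℚ (allSubsets q) (λ B → ∑ℚ L (λ M → if does (lookup M i₀ ≟ₛ B) then weightOn S M else 0ℚ))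
          ≡⟨ sum-cong ℚ-ring (allSubsets q) (λ B → sym (sum-filter ℚ-ring (λ M → lookup M i₀ ≟ₛ B) L (weightOn S))) ⟩
        ∑ℚ (allSubsets q) (λ B → ∑ℚ (withRow B) (weightOn S))
          ≡⟨ sum-cong ℚ-ring (allSubsets q) (λ B → withRow-sum B (isBlock? B)) ⟩
        ∑ℚ (allSubsets q) peeled ∎
        where open ≡-Reasoning

    factorials-─ : ∀ S B a₀ → B ⊆ₛ fibre S u a₀ →
      factorials S ≡ fromℕ ((count S u a₀ C size B) ℕ.* size B !) * factorials (S ─ B)
    factorials-─ S B a₀ B⊆ = ∏-update Fin._≟_ (allFin n) f f′ (fromℕ ((m C k) ℕ.* k !)) (Unique.allFin⁺ n) (∈-allFin a₀)
      f-a₀ (λ a a≢a₀ → cong (λ c → fromℕ (c !)) (count-─-≢ S B u B⊆ a≢a₀))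
      where
      open ≡-Reasoning
      f f′ : Fin n → ℚ
      f  a = fromℕ (count S u a !)
      f′ a = fromℕ (count (S ─ B) u a !)
      m k : ℕ
      m = count S u a₀
      k = size B
      m≡ : m ≡ count (S ─ B) u a₀ ℕ.+ k
      m≡ = count-─-≡ S B u B⊆
      f-a₀ : f a₀ ≡ fromℕ ((m C k) ℕ.* k !) * f′ a₀
      f-a₀ = begin
        fromℕ (m !)                                  ≡⟨ cong fromℕ (sym (nCk*k!*[n∸k]!≡n! k≤m)) ⟩
        fromℕ ((m C k) ℕ.* (k ! ℕ.* (m ∸ k) !))      ≡⟨ cong fromℕ (sym (ℕ.*-assoc (m C k) (k !) _)) ⟩
        fromℕ (((m C k) ℕ.* k !) ℕ.* (m ∸ k) !)      ≡⟨ fromℕ-* ((m C k) ℕ.* k !) _ ⟩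
        fromℕ ((m C k) ℕ.* k !) * fromℕ ((m ∸ k) !)  ≡⟨ cong (λ z → fromℕ ((m C k) ℕ.* k !) * fromℕ (z !)) m∸k ⟩
        fromℕ ((m C k) ℕ.* k !) * f′ a₀              ∎
        where
        k≤m : k ≤ m
        k≤m = subst (k ≤_) (sym m≡) (ℕ.m≤n+m k _)
        m∸k : m ∸ k ≡ count (S ─ B) u a₀
        m∸k = trans (cong (_∸ k) m≡) (ℕ.m+n∸n≡m _ k)

    module Empty (S : Subset q) (S-empty : ∀ i → ¬ i ∈ₛ S) where

      private
        ∅ : Relation q
        ∅ = relation (λ _ _ → false)

        ∅-admissible : Admissible u S ∅
        ∅-admissible = record { support    = λ i j t → ⊥-elim (∉∅ t) ; reflexive = λ i i∈S → ⊥-elim (S-empty i i∈S)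
                              ; symmetric  = λ i j t → ⊥-elim (∉∅ t) ; transitive = λ i j k t _ → ⊥-elim (∉∅ t) } ,
                       λ i j t → ⊥-elim (∉∅ t)
          where
          ∉∅ : ∀ {i j} → T (rel ∅ i j) → ⊥
          ∉∅ {i} {j} t with subst T (rel-relation (λ _ _ → false) i j) t
          ... | ()

        admissible⇒∅ : ∀ M → Admissible u S M → M ≡ ∅
        admissible⇒∅ M (equiv , _) = rel-ext M ∅ λ i j →
          trans (¬T⇒≡false (λ t → S-empty i (IsEquivalenceOn.support equiv i j t))) (sym (rel-relation (λ _ _ → false) i j))

        only-∅ : filter (admissible? u S) (allRelations q) ↭ ∅ ∷ []
        only-∅ = ↭-fromUnique (Unique.filter⁺ (admissible? u S) (allRelations-unique q)) (All.[] ∷ [])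
          (λ {M} M∈ → here (admissible⇒∅ M (proj₂ (∈-filter⁻ (admissible? u S) {xs = allRelations q} M∈))))
          (λ { (here refl) → ∈-filter⁺ (admissible? u S) (allRelations-complete ∅) ∅-admissible })

      partitionSum-empty : partitionSum S ≡ 1ℚ
      partitionSum-empty = trans (sum-↭ ℚ-ring (weightOn S) only-∅)
        (trans (ℚ.+-identityʳ (weightOn S ∅)) (∏-one (allFin q) (λ i _ → factor-∉ S ∅ (¬T⇒≡false (S-empty i)))))

      factorials-empty : factorials S ≡ 1ℚ
      factorials-empty = ∏-one (allFin n) (λ a _ → cong (λ c → fromℕ (c !)) (count-empty S u a S-empty))

    private
      carlitzOverFact*k! : ∀ k → carlitzOverFact k * fromℕ (k !) ≡ Carlitz k
      carlitzOverFact*k! k = trans (ℚ.*-assoc (Carlitz k) _ (fromℕ (k !)))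
        (trans (cong (Carlitz k *_) (1/n*n≡1 (k !) {{k ℕ.!≢0}})) (ℚ.*-identityʳ (Carlitz k)))

      carlitz-recurrence-padded : ∀ m → 1 ≤ m → m ≤ q →
        ∑< (suc q) (λ j → fromℕ ((m ∸ 1) C j) * (Carlitz (j ℕ.+ 1) * fromℕ (m C (j ℕ.+ 1)))) ≡ 1ℚ
      carlitz-recurrence-padded (suc M) _ M<q = begin
        ∑< (suc q) (λ j → fromℕ (M C j) * (Carlitz (j ℕ.+ 1) * fromℕ (suc M C (j ℕ.+ 1))))
          ≡⟨ ∑<-cong (suc q) (λ j _ → regroup j) ⟩
        ∑< (suc q) f
          ≡⟨ ∑<-vanishing (suc M) (suc q) f (ℕ.m≤n⇒m≤1+n M<q)
               (λ i M<i → trans (cong (λ c → fromℕ (c ℕ.* (suc M C suc i)) * Carlitz (suc i)) (k>n⇒nCk≡0 M<i))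
                                (ℚ.*-zeroˡ (Carlitz (suc i)))) ⟩
        ∑< (suc M) f ≡⟨ carlitz-recurrence M ⟩
        1ℚ ∎
        where
        open ≡-Reasoning
        f : ℕ → ℚ
        f j = fromℕ ((M C j) ℕ.* (suc M C suc j)) * Carlitz (suc j)
        regroup : ∀ j → fromℕ (M C j) * (Carlitz (j ℕ.+ 1) * fromℕ (suc M C (j ℕ.+ 1))) ≡ f j
        regroup j rewrite ℕ.+-comm j 1 =
          trans (solve 3 (λ a c b → a :* (c :* b) := (a :* b) :* c) refl (fromℕ (M C j)) (Carlitz (suc j)) (fromℕ (suc M C suc j)))
                (cong (_* Carlitz (suc j)) (sym (fromℕ-* (M C j) (suc M C suc j))))

    module Step (S : Subset q) (i₀ : Fin q) (i₀∈S : i₀ ∈ₛ S) (i₀-least : ∀ j → toℕ j < toℕ i₀ → ¬ j ∈ₛ S) where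
      open Peel S i₀ i₀∈S i₀-least
      open BlockDecomposition u S i₀ i₀∈S i₀-least using (IsBlock; a₀)

      private
        X : Subset q
        X = fibre S u a₀
        m : ℕ
        m = count S u a₀

        φ : ℕ → ℚ
        φ k = Carlitz k * fromℕ (m C k)

        i₀∈X : i₀ ∈ₛ X
        i₀∈X = ∈-fibre⁺ S u i₀∈S refl

        isBlock≡between : ∀ B → does (isBlock? B) ≡ between ⁅ i₀ ⁆ B X
        isBlock≡between B = does-reflects (isBlock? B) (between ⁅ i₀ ⁆ B X)
          (λ (i₀∈B , B⊆X) → between⁺ ⁅ i₀ ⁆ B X (λ i i∈ → subst (_∈ₛ B) (sym (∈-⁅⁆⁻ i∈)) i₀∈B) B⊆X)
          (λ t → let (⁅i₀⁆⊆B , B⊆X) = between⁻ ⁅ i₀ ⁆ B X t in ⁅i₀⁆⊆B i₀ (i∈⁅i⁆ i₀) , B⊆X)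

      smaller : ∀ B → IsBlock B → size (S ─ B) < size S
      smaller B (i₀∈B , B⊆X) = ℕ.<-≤-trans (ℕ.m<m+n (size (S ─ B)) (size-pos B i₀∈B))
        (ℕ.≤-reflexive (sym (size-─ S B (λ i i∈B → proj₁ (∈-fibre⁻ S u (B⊆X i i∈B))))))

      module _ (IH : ∀ B → IsBlock B → partitionSum (S ─ B) * factorials (S ─ B) ≡ 1ℚ) where

        private
          term : ∀ B (block? : Dec (IsBlock B)) →
            (if does block? then carlitzOverFact (size B) * partitionSum (S ─ B) else 0ℚ) * factorials S
              ≡ (if does block? then φ (size B) else 0ℚ)
          term B (no _)                  = ℚ.*-zeroˡ (factorials S)
          term B (yes block@(_ , B⊆X)) = begin
            c * P′ * factorials S                                ≡⟨ cong (c * P′ *_) (factorials-─ S B a₀ B⊆X) ⟩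
            c * P′ * (fromℕ ((m C k) ℕ.* k !) * F′)              ≡⟨ cong (λ z → c * P′ * (z * F′)) (fromℕ-* (m C k) (k !)) ⟩
            c * P′ * (fromℕ (m C k) * fromℕ (k !) * F′)
              ≡⟨ solve 5 (λ c p b t f → c :* p :* (b :* t :* f) := (c :* t) :* b :* (p :* f)) refl c P′ (fromℕ (m C k)) (fromℕ (k !)) F′ ⟩
            (c * fromℕ (k !)) * fromℕ (m C k) * (P′ * F′)
              ≡⟨ cong₂ (λ x y → x * fromℕ (m C k) * y) (carlitzOverFact*k! k) (IH B block) ⟩
            Carlitz k * fromℕ (m C k) * 1ℚ                       ≡⟨ ℚ.*-identityʳ _ ⟩
            φ k                                                  ∎
            where
            open ≡-Reasoning
            k : ℕ
            k  = size B
            c P′ F′ : ℚ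
            c  = carlitzOverFact k
            P′ = partitionSum (S ─ B)
            F′ = factorials (S ─ B)

        partitionSum*factorials-step : partitionSum S * factorials S ≡ 1ℚ
        partitionSum*factorials-step = begin
          partitionSum S * factorials S
            ≡⟨ cong (_* factorials S) partitionSum-peel ⟩
          ∑ℚ (allSubsets q) peeled * factorials S
            ≡⟨ sum-*ʳ ℚ-ring (allSubsets q) (factorials S) peeled ⟩
          ∑ℚ (allSubsets q) (λ B → peeled B * factorials S)
            ≡⟨ sum-cong ℚ-ring (allSubsets q) (λ B →
                 trans (term B (isBlock? B)) (cong (λ b → if b then φ (size B) else 0ℚ) (isBlock≡between B))) ⟩
          ∑ℚ (allSubsets q) (λ B → if between ⁅ i₀ ⁆ B X then φ (size B) else 0ℚ)
            ≡⟨ sum-between X ⁅ i₀ ⁆ φ (λ i i∈ → subst (_∈ₛ X) (sym (∈-⁅⁆⁻ i∈)) i₀∈X) ⟩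
          ∑< (suc q) (λ j → fromℕ ((size X ∸ size ⁅ i₀ ⁆) C j) * φ (j ℕ.+ size ⁅ i₀ ⁆))
            ≡⟨ cong (λ s → ∑< (suc q) (λ j → fromℕ ((m ∸ s) C j) * φ (j ℕ.+ s))) (size-⁅⁆ i₀) ⟩
          ∑< (suc q) (λ j → fromℕ ((m ∸ 1) C j) * φ (j ℕ.+ 1))
            ≡⟨ carlitz-recurrence-padded m (size-pos X i₀∈X) (size≤ X) ⟩
          1ℚ ∎
          where open ≡-Reasoning

    partitionSum*factorials : ∀ S → partitionSum S * factorials S ≡ 1ℚ
    partitionSum*factorials S = go S (On.wellFounded size ℕ.<-wellFounded S)
      where
      go : ∀ S → Acc (λ S′ S → size S′ < size S) S → partitionSum S * factorials S ≡ 1ℚ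
      go S (acc smaller-acc) with any? (λ i → T? (lookup S i))
      ... | no S-empty = let open Empty S (λ i i∈S → S-empty (i , i∈S))
                         in trans (cong₂ _*_ partitionSum-empty factorials-empty) (ℚ.*-identityˡ 1ℚ)
      ... | yes (i , i∈S) with least S i∈S
      ...   | i₀ , i₀∈S , i₀-least = let open Step S i₀ i₀∈S i₀-least
                                     in partitionSum*factorials-step (λ B block → go (S ─ B) (smaller-acc (smaller B block)))

module Multinomial where

  open import Algebra.Bundles using (CommutativeRing)
  open import Level using (0ℓ)
  open import Data.Bool using (true; if_then_else_)
  open import Data.Empty using (⊥-elim)
  open import Data.Fin as Fin using (Fin; zero; suc)
  open import Data.List as List using (List; []; _∷_; allFin; filter; map; length)
  import Data.List.Properties as List
  open import Data.List.Membership.Propositional.Properties using (∈-allFin)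
  import Data.List.Relation.Unary.Unique.Propositional.Properties as Unique
  open import Data.Nat as ℕ using (ℕ; zero; suc; _≤_; z≤n; s≤s; _!)
  import Data.Nat.Properties as ℕ
  open import Data.Nat.Solver using (module +-*-Solver)
  open import Data.Product using (_×_; _,_; proj₁; proj₂)
  open import Data.Rational as ℚ using (ℚ; 0ℚ; 1ℚ; _*_; _+_)
  import Data.Rational.Properties as ℚ
  open import Data.Rational.Solver as ℚ-Solver using ()
  open import Data.Vec as Vec using (Vec; []; _∷_; lookup; tabulate; updateAt)
  import Data.Vec.Properties as Vec
  open import Function using (_∘_; id)
  open import Relation.Binary.PropositionalEquality
  open import Relation.Nullary using (Dec; yes; no; does; ¬_)
  open import Relation.Nullary.Decidable using (dec-true; dec-false)
  open ≡-Reasoning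

  open import Defs using (allVecs)
  open Fractions using (fromℕ; fromℕ-+; fromℕ-*; fromℕ-suc)
  open ListSum
  open ListProduct
  open Subsets using (Subset; bit; count)
  open Prelude using (vec-ext; does-cong)

  private
    ℚ-ring : CommutativeRing 0ℓ 0ℓ
    ℚ-ring = ℚ.+-*-commutativeRing

    ∑ℚ : ∀ {a} {A : Set a} → List A → (A → ℚ) → ℚ
    ∑ℚ = ∑ ℚ-ring

  full : ∀ k → Subset k
  full k = Vec.replicate k true

  multiplicities : ∀ {n k} → Vec (Fin n) k → Vec ℕ n
  multiplicities {k = k} v = tabulate (count (full k) v)

  _≟ₘ_ : ∀ {n} (x y : Vec ℕ n) → Dec (x ≡ y)
  _≟ₘ_ = Vec.≡-dec ℕ._≟_

  lookup-multiplicities : ∀ {n k} (v : Vec (Fin n) k) a → lookup (multiplicities v) a ≡ count (full k) v a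
  lookup-multiplicities v a = Vec.lookup∘tabulate _ a

  lookup-multiplicities-∷ : ∀ {n k} (x : Fin n) (v : Vec (Fin n) k) a →
    lookup (multiplicities (x ∷ v)) a ≡ bit (does (x Fin.≟ a)) ℕ.+ lookup (multiplicities v) a
  lookup-multiplicities-∷ x v a =
    trans (lookup-multiplicities (x ∷ v) a) (cong (bit (does (x Fin.≟ a)) ℕ.+_) (sym (lookup-multiplicities v a)))

  private
    sum-tabulate-+ : ∀ {n} (f g : Fin n → ℕ) → Vec.sum (tabulate (λ a → f a ℕ.+ g a)) ≡ Vec.sum (tabulate f) ℕ.+ Vec.sum (tabulate g)
    sum-tabulate-+ {zero}  f g = refl
    sum-tabulate-+ {suc n} f g = trans (cong (f zero ℕ.+ g zero ℕ.+_) (sum-tabulate-+ (f ∘ suc) (g ∘ suc)))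
      (solve 4 (λ a b c d → (a :+ b) :+ (c :+ d) := (a :+ c) :+ (b :+ d)) refl
         (f zero) (g zero) (Vec.sum (tabulate (f ∘ suc))) (Vec.sum (tabulate (g ∘ suc))))
      where open +-*-Solver

    sum-tabulate-0 : ∀ n → Vec.sum (tabulate {n = n} (λ _ → 0)) ≡ 0
    sum-tabulate-0 zero    = refl
    sum-tabulate-0 (suc n) = sum-tabulate-0 n

    sum-indicator : ∀ {n} (x : Fin n) → Vec.sum (tabulate (λ a → bit (does (x Fin.≟ a)))) ≡ 1
    sum-indicator {suc n} zero    = cong suc (sum-tabulate-0 n)
    sum-indicator {suc n} (suc x) = sum-indicator x

  sum-multiplicities : ∀ {n k} (v : Vec (Fin n) k) → Vec.sum (multiplicities v) ≡ k
  sum-multiplicities {n} []      = sum-tabulate-0 n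
  sum-multiplicities {n} {suc k} (x ∷ v) = begin
    Vec.sum (tabulate (λ a → bit (does (x Fin.≟ a)) ℕ.+ count (full k) v a))
      ≡⟨ sum-tabulate-+ (λ a → bit (does (x Fin.≟ a))) (count (full k) v) ⟩
    Vec.sum (tabulate (λ a → bit (does (x Fin.≟ a)))) ℕ.+ Vec.sum (multiplicities v)
      ≡⟨ cong₂ ℕ._+_ (sum-indicator x) (sum-multiplicities v) ⟩
    suc k ∎

  lower : ∀ {n} → Vec ℕ n → Fin n → Vec ℕ n
  lower p x = updateAt p x ℕ.pred

  multiplicities-∷⁻ : ∀ {n k} (x : Fin n) (v : Vec (Fin n) k) (p : Vec ℕ n) →
    multiplicities (x ∷ v) ≡ p → 1 ≤ lookup p x × multiplicities v ≡ lower p x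
  multiplicities-∷⁻ x v p refl = subst (1 ≤_) (sym p-x) (s≤s z≤n) , vec-ext (multiplicities v) (lower p x) pointwise
    where
    p-x : lookup p x ≡ suc (lookup (multiplicities v) x)
    p-x = trans (lookup-multiplicities-∷ x v x) (cong (λ b → bit b ℕ.+ lookup (multiplicities v) x) (dec-true (x Fin.≟ x) refl))
    pointwise : ∀ a → lookup (multiplicities v) a ≡ lookup (lower p x) a
    pointwise a with a Fin.≟ x
    ... | yes refl = sym (trans (Vec.lookup∘updateAt a p) (cong ℕ.pred p-x))
    ... | no a≢x   = sym (trans (Vec.lookup∘updateAt′ a x a≢x p)
                       (trans (lookup-multiplicities-∷ x v a)
                              (cong (λ b → bit b ℕ.+ lookup (multiplicities v) a) (dec-false (x Fin.≟ a) (a≢x ∘ sym)))))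

  multiplicities-∷⁺ : ∀ {n k} (x : Fin n) (v : Vec (Fin n) k) (p : Vec ℕ n) →
    1 ≤ lookup p x → multiplicities v ≡ lower p x → multiplicities (x ∷ v) ≡ p
  multiplicities-∷⁺ x v p 1≤p-x v≡ = vec-ext (multiplicities (x ∷ v)) p pointwise
    where
    pointwise : ∀ a → lookup (multiplicities (x ∷ v)) a ≡ lookup p a
    pointwise a with a Fin.≟ x
    ... | yes refl = begin
      lookup (multiplicities (a ∷ v)) a              ≡⟨ lookup-multiplicities-∷ a v a ⟩
      bit (does (a Fin.≟ a)) ℕ.+ lookup (multiplicities v) a
        ≡⟨ cong₂ (λ b c → bit b ℕ.+ c) (dec-true (a Fin.≟ a) refl) (trans (cong (λ w → lookup w a) v≡) (Vec.lookup∘updateAt a p)) ⟩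
      suc (ℕ.pred (lookup p a))                       ≡⟨ ℕ.suc-pred (lookup p a) {{ℕ.>-nonZero 1≤p-x}} ⟩
      lookup p a                                      ∎
    ... | no a≢x = begin
      lookup (multiplicities (x ∷ v)) a              ≡⟨ lookup-multiplicities-∷ x v a ⟩
      bit (does (x Fin.≟ a)) ℕ.+ lookup (multiplicities v) a
        ≡⟨ cong₂ (λ b c → bit b ℕ.+ c) (dec-false (x Fin.≟ a) (a≢x ∘ sym))
                 (trans (cong (λ w → lookup w a) v≡) (Vec.lookup∘updateAt′ a x a≢x p)) ⟩
      lookup p a                                      ∎

  sum-lower : ∀ {n} (p : Vec ℕ n) x → 1 ≤ lookup p x → suc (Vec.sum (lower p x)) ≡ Vec.sum p
  sum-lower (suc c ∷ p) zero    _     = refl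
  sum-lower (c ∷ p)     (suc x) 1≤p-x = trans (sym (ℕ.+-suc c _)) (cong (c ℕ.+_) (sum-lower p x 1≤p-x))

  private
    sum-fromℕ : ∀ {m} (p : Vec ℕ m) → ∑ℚ (allFin m) (λ a → fromℕ (lookup p a)) ≡ fromℕ (Vec.sum p)
    sum-fromℕ []              = refl
    sum-fromℕ {suc m} (c ∷ p) = begin
      fromℕ c + ∑ℚ (List.tabulate suc) (λ a → fromℕ (lookup (c ∷ p) a))
        ≡⟨ cong (fromℕ c +_) (trans (cong (λ l → ∑ℚ l (λ a → fromℕ (lookup (c ∷ p) a))) (sym (List.map-tabulate id suc)))
                                    (sum-map ℚ-ring (allFin m) suc (λ a → fromℕ (lookup (c ∷ p) a)))) ⟩
      fromℕ c + ∑ℚ (allFin m) (λ a → fromℕ (lookup p a)) ≡⟨ cong (fromℕ c +_) (sum-fromℕ p) ⟩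
      fromℕ c + fromℕ (Vec.sum p)                        ≡⟨ sym (fromℕ-+ c (Vec.sum p)) ⟩
      fromℕ (c ℕ.+ Vec.sum p)                            ∎

  module _ {n : ℕ} where

    withMultiplicities : ∀ q → Vec ℕ n → List (Vec (Fin n) q)
    withMultiplicities q p = filter (λ v → multiplicities v ≟ₘ p) (allVecs (allFin n) q)

    factorialProduct : Vec ℕ n → ℚ
    factorialProduct p = ∏ (allFin n) (λ a → fromℕ (lookup p a !))

    private
      V : ∀ q → List (Vec (Fin n) q)
      V q = allVecs (allFin n) q

      hasMultiplicities : ∀ {q} → Vec ℕ n → Vec (Fin n) q → ℚ
      hasMultiplicities p v = if does (multiplicities v ≟ₘ p) then 1ℚ else 0ℚ

      fromℕ-length : ∀ {a} {A : Set a} (xs : List A) → fromℕ (length xs) ≡ ∑ℚ xs (λ _ → 1ℚ)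
      fromℕ-length []       = refl
      fromℕ-length (x ∷ xs) = trans (fromℕ-suc (length xs)) (cong (1ℚ +_) (fromℕ-length xs))

      fromℕ-#withMultiplicities : ∀ q p → fromℕ (length (withMultiplicities q p)) ≡ ∑ℚ (V q) (hasMultiplicities p)
      fromℕ-#withMultiplicities q p =
        trans (fromℕ-length (withMultiplicities q p)) (sum-filter ℚ-ring (λ v → multiplicities v ≟ₘ p) (V q) (λ _ → 1ℚ))

      factorialProduct-lower : ∀ p x → 1 ≤ lookup p x → factorialProduct p ≡ fromℕ (lookup p x) * factorialProduct (lower p x)
      factorialProduct-lower p x 1≤p-x = ∏-update Fin._≟_ (allFin n) _ _ (fromℕ (lookup p x)) (Unique.allFin⁺ n) (∈-allFin x)
        (trans (fact-suc (lookup p x) 1≤p-x) (cong (λ c → fromℕ (lookup p x) * fromℕ (c !)) (sym (Vec.lookup∘updateAt x p))))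
        (λ a a≢x → cong (λ c → fromℕ (c !)) (sym (Vec.lookup∘updateAt′ a x a≢x p)))
        where
        fact-suc : ∀ c → 1 ≤ c → fromℕ (c !) ≡ fromℕ c * fromℕ (ℕ.pred c !)
        fact-suc (suc c) _ = fromℕ-* (suc c) (c !)

      count-first-letter : ∀ q p x (1≤p-x? : Dec (1 ≤ lookup p x)) →
        ∑ℚ (V q) (λ v → hasMultiplicities p (x ∷ v)) ≡ (if does 1≤p-x? then fromℕ (length (withMultiplicities q (lower p x))) else 0ℚ)
      count-first-letter q p x (yes 1≤p-x) = trans
        (sum-cong ℚ-ring (V q) (λ v → cong (λ b → if b then 1ℚ else 0ℚ)
          (does-cong (multiplicities (x ∷ v) ≟ₘ p) (multiplicities v ≟ₘ lower p x)
            (proj₂ ∘ multiplicities-∷⁻ x v p) (multiplicities-∷⁺ x v p 1≤p-x))))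
        (sym (fromℕ-#withMultiplicities q (lower p x)))
      count-first-letter q p x (no ¬1≤p-x) = trans
        (sum-cong ℚ-ring (V q) (λ v → cong (λ b → if b then 1ℚ else 0ℚ)
          (dec-false (multiplicities (x ∷ v) ≟ₘ p) (¬1≤p-x ∘ proj₁ ∘ multiplicities-∷⁻ x v p))))
        (sum-0 ℚ-ring (V q))

    multinomial : ∀ q (p : Vec ℕ n) → Vec.sum p ≡ q → fromℕ (length (withMultiplicities q p)) * factorialProduct p ≡ fromℕ (q !)
    multinomial zero    p sum≡0 = begin
      fromℕ (length (withMultiplicities 0 p)) * factorialProduct p
        ≡⟨ cong₂ _*_ (fromℕ-#withMultiplicities 0 p) (∏-one (allFin n) (λ a _ → cong (λ c → fromℕ (c !)) (p≡0 p sum≡0 a))) ⟩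
      (hasMultiplicities p [] + 0ℚ) * 1ℚ
        ≡⟨ cong (λ b → ((if b then 1ℚ else 0ℚ) + 0ℚ) * 1ℚ)
                (dec-true (multiplicities [] ≟ₘ p)
                          (vec-ext (multiplicities []) p (λ a → trans (lookup-multiplicities [] a) (sym (p≡0 p sum≡0 a))))) ⟩
      1ℚ ∎
      where
      p≡0 : ∀ {n} (p : Vec ℕ n) → Vec.sum p ≡ 0 → ∀ a → lookup p a ≡ 0
      p≡0 (zero ∷ p) _ zero    = refl
      p≡0 (zero ∷ p) e (suc a) = p≡0 p e a
    multinomial (suc q) p sum≡1+q = begin
      fromℕ (length (withMultiplicities (suc q) p)) * factorialProduct p
        ≡⟨ cong (_* factorialProduct p) (fromℕ-#withMultiplicities (suc q) p) ⟩
      ∑ℚ (V (suc q)) (hasMultiplicities p) * factorialProduct p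
        ≡⟨ cong (_* factorialProduct p) (sum-concatMap ℚ-ring (allFin n) (λ x → map (x ∷_) (V q)) (hasMultiplicities p)) ⟩
      ∑ℚ (allFin n) (λ x → ∑ℚ (map (x ∷_) (V q)) (hasMultiplicities p)) * factorialProduct p
        ≡⟨ cong (_* factorialProduct p) (sum-cong ℚ-ring (allFin n) (λ x →
             trans (sum-map ℚ-ring (V q) (x ∷_) (hasMultiplicities p)) (count-first-letter q p x (1 ℕ.≤? lookup p x)))) ⟩
      ∑ℚ (allFin n) (λ x → g x (1 ℕ.≤? lookup p x)) * factorialProduct p
        ≡⟨ sum-*ʳ ℚ-ring (allFin n) (factorialProduct p) (λ x → g x (1 ℕ.≤? lookup p x)) ⟩
      ∑ℚ (allFin n) (λ x → g x (1 ℕ.≤? lookup p x) * factorialProduct p)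
        ≡⟨ sum-cong ℚ-ring (allFin n) (λ x → term x (1 ℕ.≤? lookup p x)) ⟩
      ∑ℚ (allFin n) (λ x → fromℕ (lookup p x) * fromℕ (q !))
        ≡⟨ sym (sum-*ʳ ℚ-ring (allFin n) (fromℕ (q !)) (λ x → fromℕ (lookup p x))) ⟩
      ∑ℚ (allFin n) (λ x → fromℕ (lookup p x)) * fromℕ (q !)
        ≡⟨ cong (_* fromℕ (q !)) (trans (sum-fromℕ p) (cong fromℕ sum≡1+q)) ⟩
      fromℕ (suc q) * fromℕ (q !)
        ≡⟨ sym (fromℕ-* (suc q) (q !)) ⟩
      fromℕ (suc q !) ∎
      where
      g : ∀ x → Dec (1 ≤ lookup p x) → ℚ
      g x d = if does d then fromℕ (length (withMultiplicities q (lower p x))) else 0ℚ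
      term : ∀ x (d : Dec (1 ≤ lookup p x)) → g x d * factorialProduct p ≡ fromℕ (lookup p x) * fromℕ (q !)
      term x (yes 1≤p-x) = begin
        N′ * factorialProduct p                             ≡⟨ cong (N′ *_) (factorialProduct-lower p x 1≤p-x) ⟩
        N′ * (fromℕ (lookup p x) * factorialProduct (lower p x))
          ≡⟨ ℚ-Solver.+-*-Solver.solve 3 (λ a b c → a :* (b :* c) := b :* (a :* c)) refl N′ (fromℕ (lookup p x)) (factorialProduct (lower p x)) ⟩
        fromℕ (lookup p x) * (N′ * factorialProduct (lower p x))
          ≡⟨ cong (fromℕ (lookup p x) *_) (multinomial q (lower p x) (ℕ.suc-injective (trans (sum-lower p x 1≤p-x) sum≡1+q))) ⟩
        fromℕ (lookup p x) * fromℕ (q !) ∎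
        where
        open ℚ-Solver.+-*-Solver using (_:*_; _:=_)
        N′ : ℚ
        N′ = fromℕ (length (withMultiplicities q (lower p x)))
      term x (no ¬1≤p-x) = trans (ℚ.*-zeroˡ (factorialProduct p))
        (sym (trans (cong (λ c → fromℕ c * fromℕ (q !)) (p-x≡0 (lookup p x) ¬1≤p-x)) (ℚ.*-zeroˡ (fromℕ (q !)))))
        where
        p-x≡0 : ∀ c → ¬ 1 ≤ c → c ≡ 0
        p-x≡0 zero    _ = refl
        p-x≡0 (suc c) h = ⊥-elim (h (s≤s z≤n))

module AbelianSquare where

  open import Data.Fin as Fin using (Fin; zero; suc; punchIn)
  open import Data.Fin.Permutation as Permutation using (Permutation′; _⟨$⟩ʳ_)
  open import Data.List using (List; allFin; filter; map)
  open import Data.List.Membership.Propositional using (_∈_)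
  open import Data.List.Membership.Propositional.Properties using (∈-filter⁺; ∈-filter⁻; ∈-map⁺; ∈-map⁻; ∈-allFin)
  open import Data.List.Relation.Binary.Permutation.Propositional using (_↭_)
  open import Data.List.Relation.Unary.Unique.Propositional using (Unique)
  import Data.List.Relation.Unary.Unique.Propositional.Properties as Unique
  open import Data.Nat as ℕ using (ℕ; zero; suc; _≤_; z≤n; s≤s)
  import Data.Nat.Properties as ℕ
  open import Data.Nat.Solver using (module +-*-Solver)
  open import Data.Product using (Σ; _,_; proj₁; proj₂)
  open import Data.Vec as Vec using (Vec; []; _∷_; lookup; tabulate; _++_; removeAt)
  import Data.Vec.Properties as Vec
  open import Function.Bundles using (_⇔_; mk⇔; Equivalence)
  open import Relation.Binary.PropositionalEquality
  open import Relation.Nullary using (Dec; yes; no; does)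
  open import Relation.Nullary.Decidable using (dec-true)
  import Algebra.Properties.CommutativeMonoid.Sum as CommutativeMonoidSum
  open ≡-Reasoning

  open import Defs using (fstHalf; IsAbelianSquare; allVecs)
  open Enumeration using (allVecs-unique; allVecs-complete)
  open Subsets using (bit; count)
  open Prelude using (↭-fromUnique; vec-ext)
  open Multinomial

  private
    module ℕ-Sum = CommutativeMonoidSum ℕ.+-0-commutativeMonoid

    count-full≡sum : ∀ {n k} (v : Vec (Fin n) k) a → count (full k) v a ≡ ℕ-Sum.sum (λ i → bit (does (lookup v i Fin.≟ a)))
    count-full≡sum []      a = refl
    count-full≡sum (x ∷ v) a = cong (bit (does (x Fin.≟ a)) ℕ.+_) (count-full≡sum v a)

  multiplicities-permute : ∀ {n q} (u v : Vec (Fin n) q) (σ : Permutation′ q) →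
    (∀ k → lookup u (σ ⟨$⟩ʳ k) ≡ lookup v k) → multiplicities v ≡ multiplicities u
  multiplicities-permute u v σ u∘σ≡v = vec-ext (multiplicities v) (multiplicities u) λ a → begin
    lookup (multiplicities v) a                              ≡⟨ lookup-multiplicities v a ⟩
    count (full _) v a                                       ≡⟨ count-full≡sum v a ⟩
    ℕ-Sum.sum (λ k → bit (does (lookup v k Fin.≟ a)))
      ≡⟨ ℕ-Sum.sum-cong-≗ (λ k → cong (λ z → bit (does (z Fin.≟ a))) (sym (u∘σ≡v k))) ⟩
    ℕ-Sum.sum (λ k → bit (does (lookup u (σ ⟨$⟩ʳ k) Fin.≟ a))) ≡⟨ sym (ℕ-Sum.sum-permute (λ j → bit (does (lookup u j Fin.≟ a))) σ) ⟩
    ℕ-Sum.sum (λ j → bit (does (lookup u j Fin.≟ a)))       ≡⟨ sym (count-full≡sum u a) ⟩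
    count (full _) u a                                       ≡⟨ sym (lookup-multiplicities u a) ⟩
    lookup (multiplicities u) a                              ∎

  private
    lookup-removeAt : ∀ {a} {A : Set a} {n} (xs : Vec A (suc n)) i k → lookup (removeAt xs i) k ≡ lookup xs (punchIn i k)
    lookup-removeAt (x ∷ xs)     zero    k       = refl
    lookup-removeAt (x ∷ y ∷ ys) (suc i) zero    = refl
    lookup-removeAt (x ∷ y ∷ ys) (suc i) (suc k) = lookup-removeAt (y ∷ ys) i k

    count-removeAt : ∀ {n k} (u : Vec (Fin n) (suc k)) j a →
      count (full (suc k)) u a ≡ bit (does (lookup u j Fin.≟ a)) ℕ.+ count (full k) (removeAt u j) a
    count-removeAt (x ∷ u)     zero    a = refl
    count-removeAt (x ∷ y ∷ ys) (suc j) a =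
      trans (cong (bit (does (x Fin.≟ a)) ℕ.+_) (count-removeAt (y ∷ ys) j a))
        (solve 3 (λ b c d → b :+ (c :+ d) := c :+ (b :+ d)) refl
           (bit (does (x Fin.≟ a))) (bit (does (lookup (y ∷ ys) j Fin.≟ a))) (count (full _) (removeAt (y ∷ ys) j) a))
      where open +-*-Solver

    occurs : ∀ {n k} (u : Vec (Fin n) k) y → 1 ≤ count (full k) u y → Σ (Fin k) λ j → lookup u j ≡ y
    occurs (x ∷ u) y 1≤ with x Fin.≟ y
    ... | yes x≡y = zero , x≡y
    ... | no  _   = let (j , u-j≡y) = occurs u y 1≤ in suc j , u-j≡y

  -- Equal multiplicities give a rearrangement, built one letter at a time.
  permutation : ∀ {n q} (u v : Vec (Fin n) q) → multiplicities v ≡ multiplicities u →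
    Σ (Permutation′ q) λ σ → ∀ k → lookup u (σ ⟨$⟩ʳ k) ≡ lookup v k
  permutation []  []       _ = Permutation.id , λ ()
  permutation {n} {suc q} u (y ∷ v′) mult≡ = σ , u∘σ≡v
    where
    counts : ∀ a → bit (does (y Fin.≟ a)) ℕ.+ count (full q) v′ a ≡ count (full (suc q)) u a
    counts a = trans (sym (lookup-multiplicities (y ∷ v′) a)) (trans (cong (λ w → lookup w a) mult≡) (lookup-multiplicities u a))
    y-occurs : Σ (Fin (suc q)) λ j → lookup u j ≡ y
    y-occurs = occurs u y (subst (1 ≤_) (trans (cong (λ b → bit b ℕ.+ count (full q) v′ y) (sym (dec-true (y Fin.≟ y) refl)))
                                              (counts y))
                                       (s≤s z≤n))
    j : Fin (suc q)
    j = proj₁ y-occurs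
    u′ : Vec (Fin n) q
    u′ = removeAt u j
    mult′≡ : multiplicities v′ ≡ multiplicities u′
    mult′≡ = vec-ext (multiplicities v′) (multiplicities u′) λ a → trans (lookup-multiplicities v′ a) (trans
      (ℕ.+-cancelˡ-≡ (bit (does (y Fin.≟ a))) _ _
        (trans (counts a) (trans (count-removeAt u j a) (cong (λ z → bit (does (z Fin.≟ a)) ℕ.+ count (full q) u′ a) (proj₂ y-occurs)))))
      (sym (lookup-multiplicities u′ a)))
    σ′ : Σ (Permutation′ q) λ σ → ∀ k → lookup u′ (σ ⟨$⟩ʳ k) ≡ lookup v′ k
    σ′ = permutation u′ v′ mult′≡
    σ : Permutation′ (suc q)
    σ = Permutation.insert zero j (proj₁ σ′)
    u∘σ≡v : ∀ k → lookup u (σ ⟨$⟩ʳ k) ≡ lookup (y ∷ v′) k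
    u∘σ≡v zero    = proj₂ y-occurs
    u∘σ≡v (suc k) = trans (cong (lookup u) (Permutation.insert-punchIn zero j (proj₁ σ′) k))
                          (trans (sym (lookup-removeAt u j (proj₁ σ′ ⟨$⟩ʳ k))) (proj₂ σ′ k))

  isAbelianSquare⇔ : ∀ {n q} (u v : Vec (Fin n) q) → IsAbelianSquare q (u ++ v) ⇔ (multiplicities v ≡ multiplicities u)
  isAbelianSquare⇔ {q = q} u v = mk⇔
    (λ (σ , sq) → multiplicities-permute u v σ λ k → trans (sym (Vec.lookup-++ˡ u v (σ ⟨$⟩ʳ k))) (trans (sq k) (Vec.lookup-++ʳ u v k)))
    (λ mult≡ → let (σ , u∘σ≡v) = permutation u v mult≡
               in σ , λ k → trans (Vec.lookup-++ˡ u v (σ ⟨$⟩ʳ k)) (trans (u∘σ≡v k) (sym (Vec.lookup-++ʳ u v k))))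

  firstHalf : ∀ {n} q → Vec (Fin n) (q ℕ.+ q) → Vec (Fin n) q
  firstHalf q t = tabulate (fstHalf q t)

  firstHalf-++ : ∀ {n q} (u v : Vec (Fin n) q) → firstHalf q (u ++ v) ≡ u
  firstHalf-++ u v = vec-ext _ u (λ k → trans (Vec.lookup∘tabulate _ k) (Vec.lookup-++ˡ u v k))

  _≟ᵥ_ : ∀ {n k} (x y : Vec (Fin n) k) → Dec (x ≡ y)
  _≟ᵥ_ = Vec.≡-dec Fin._≟_

  withFirstHalf↭rearrangements : ∀ {q n} (A : List (Vec (Fin n) (q ℕ.+ q))) → Unique A → (∀ t → (t ∈ A) ⇔ IsAbelianSquare q t) →
    ∀ u → filter (λ t → firstHalf q t ≟ᵥ u) A ↭ map (u ++_) (withMultiplicities q (multiplicities u))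
  withFirstHalf↭rearrangements {q} {n} A unique-A A⇔ u = ↭-fromUnique
    (Unique.filter⁺ (λ t → firstHalf q t ≟ᵥ u) unique-A)
    (Unique.map⁺ (Vec.++-injectiveʳ u u) (Unique.filter⁺ _ (allVecs-unique (allFin n) q (Unique.allFin⁺ n))))
    to from
    where
    F = withMultiplicities q (multiplicities u)
    to : ∀ {t} → t ∈ filter (λ t → firstHalf q t ≟ᵥ u) A → t ∈ map (u ++_) F
    to {t} t∈ with ∈-filter⁻ (λ t → firstHalf q t ≟ᵥ u) {xs = A} t∈ | Vec.splitAt q t
    ... | t∈A , first≡u | ys , zs , refl with trans (sym (firstHalf-++ ys zs)) first≡u
    ...   | refl = ∈-map⁺ (u ++_) (∈-filter⁺ (λ v → multiplicities v ≟ₘ multiplicities u) (allVecs-complete (allFin n) q ∈-allFin zs)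
                     (Equivalence.to (isAbelianSquare⇔ u zs) (Equivalence.to (A⇔ (u ++ zs)) t∈A)))
    from : ∀ {t} → t ∈ map (u ++_) F → t ∈ filter (λ t → firstHalf q t ≟ᵥ u) A
    from t∈ with ∈-map⁻ (u ++_) t∈
    ... | v , v∈F , refl = ∈-filter⁺ (λ t → firstHalf q t ≟ᵥ u)
      (Equivalence.from (A⇔ (u ++ v)) (Equivalence.from (isAbelianSquare⇔ u v)
        (proj₂ (∈-filter⁻ (λ v → multiplicities v ≟ₘ multiplicities u) {xs = allVecs (allFin n) q} v∈F))))
      (firstHalf-++ u v)

open import Algebra.Bundles using (CommutativeRing)
open import Algebra.Morphism.Structures using (IsRingHomomorphism)
open import Level using (0ℓ)
open import Data.Bool as Bool using (Bool; true; false; T; if_then_else_; _∧_)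
open import Data.Fin using (Fin)
open import Data.List as List using (List; []; _∷_; allFin; filter; map; length)
open import Data.List.Membership.Propositional using (_∈_)
open import Data.List.Membership.Propositional.Properties using (∈-allFin)
open import Data.List.Relation.Unary.Unique.Propositional using (Unique)
import Data.List.Relation.Unary.Unique.Propositional.Properties as Unique
open import Data.Nat as ℕ using (ℕ)
open import Data.Product using (_,_)
open import Data.Rational as ℚ using (ℚ; 0ℚ; 1ℚ) renaming (+-*-rawRing to ℚ-rawRing)
import Data.Rational.Properties as ℚ
open import Data.Unit using (tt)
open import Data.Vec as Vec using (Vec; _++_)
import Data.Vec.Properties as Vec
open import Function using (_∘_)
open import Function.Bundles using (_⇔_)
open import Relation.Nullary using (does)
open import Relation.Binary.PropositionalEquality as ≡ using (_≡_)

open import Defs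

open Fractions using (fromℕ; fromℕ-suc)
open ListSum
open ListProduct
open Enumeration
open Subsets using (_∈ₛ_)
open SubsetPartitions
open Prelude using (does-cong)
open PartitionSum
open Multinomial
open AbelianSquare

private
  ℚ-ring : CommutativeRing 0ℓ 0ℓ
  ℚ-ring = ℚ.+-*-commutativeRing

module _ {q n} (u : Vec (Fin n) q) where
  open import Data.Rational using (_*_)

  private
    ∈-full : ∀ i → i ∈ₛ full q
    ∈-full i = ≡.subst T (≡.sym (Vec.lookup-replicate i true)) tt

    isEquivalenceRel≡ : ∀ M → does (isEquivalenceRel? M) ≡ does (isEquivalenceOn? (full q) M)
    isEquivalenceRel≡ M = does-cong (isEquivalenceRel? M) (isEquivalenceOn? (full q) M)
      (λ (refl , sym , trans) → record { support = λ i _ _ → ∈-full i ; reflexive = λ i _ → refl i ; symmetric = sym ; transitive = trans })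
      (λ e → let open IsEquivalenceOn e in (λ i → reflexive i (∈-full i)) , symmetric , transitive)

    weight≡ : ∀ M → weight M ≡ fromℕ (q ℕ.!) * weightOn (full q) M
    weight≡ M = ≡.cong (fromℕ (q ℕ.!) *_)
      (≡.trans (∏-filter (isLeastInBlock? M) (allFin q) (λ i → carlitzOverFact (blockSize M i)))
               (∏-cong-∈ (allFin q) (λ i _ → ≡.sym (factor-∈ (full q) M (∈-full i)))))

    if-if≡scaled-if-∧ : ∀ (a b : Bool) (c x y : ℚ) → y ≡ c * x →
              (if a then (if b then y else 0ℚ) else 0ℚ) ≡ c * (if a ∧ b then x else 0ℚ)
    if-if≡scaled-if-∧ true  true  c x y y≡ = y≡
    if-if≡scaled-if-∧ true  false c x y _  = ≡.sym (ℚ.*-zeroʳ c)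
    if-if≡scaled-if-∧ false b     c x y _  = ≡.sym (ℚ.*-zeroʳ c)

  weight-sum≡partitionSum : ∑ ℚ-ring (filter (u ≺?_) (SetPartitions q)) weight ≡ fromℕ (q ℕ.!) * partitionSum u (full q)
  weight-sum≡partitionSum = begin
    ∑ ℚ-ring (filter (u ≺?_) (filter isEquivalenceRel? (allRelations q))) weight
      ≡⟨ sum-filter ℚ-ring (u ≺?_) (filter isEquivalenceRel? (allRelations q)) weight ⟩
    ∑ ℚ-ring (filter isEquivalenceRel? (allRelations q)) (λ M → if does (u ≺? M) then weight M else 0ℚ)
      ≡⟨ sum-filter ℚ-ring isEquivalenceRel? (allRelations q) (λ M → if does (u ≺? M) then weight M else 0ℚ) ⟩
    ∑ ℚ-ring (allRelations q) (λ M → if does (isEquivalenceRel? M) then (if does (u ≺? M) then weight M else 0ℚ) else 0ℚ)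
      ≡⟨ sum-cong ℚ-ring (allRelations q) (λ M →
           ≡.trans (if-if≡scaled-if-∧ (does (isEquivalenceRel? M)) (does (u ≺? M)) (fromℕ (q ℕ.!)) (weightOn (full q) M) (weight M) (weight≡ M))
                   (≡.cong (λ b → fromℕ (q ℕ.!) * (if b ∧ does (u ≺? M) then weightOn (full q) M else 0ℚ)) (isEquivalenceRel≡ M))) ⟩
    ∑ ℚ-ring (allRelations q) (λ M → fromℕ (q ℕ.!) * (if does (admissible? u (full q) M) then weightOn (full q) M else 0ℚ))
      ≡⟨ ≡.sym (sum-*ˡ ℚ-ring (allRelations q) (fromℕ (q ℕ.!))
                       (λ M → if does (admissible? u (full q) M) then weightOn (full q) M else 0ℚ)) ⟩
    fromℕ (q ℕ.!) * ∑ ℚ-ring (allRelations q) (λ M → if does (admissible? u (full q) M) then weightOn (full q) M else 0ℚ)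
      ≡⟨ ≡.cong (fromℕ (q ℕ.!) *_) (≡.sym (sum-filter ℚ-ring (admissible? u (full q)) (allRelations q) (weightOn (full q)))) ⟩
    fromℕ (q ℕ.!) * partitionSum u (full q) ∎
    where open ≡.≡-Reasoning

  weight-sum≡#rearrangements : ∑ ℚ-ring (filter (u ≺?_) (SetPartitions q)) weight ≡ fromℕ (length (withMultiplicities q (multiplicities u)))
  weight-sum≡#rearrangements = begin
    ∑ ℚ-ring (filter (u ≺?_) (SetPartitions q)) weight  ≡⟨ weight-sum≡partitionSum ⟩
    fromℕ (q ℕ.!) * partitionSum u (full q)
      ≡⟨ ≡.cong (_* partitionSum u (full q)) (≡.sym (multinomial q (multiplicities u) (sum-multiplicities u))) ⟩
    (N * factorialProduct (multiplicities u)) * partitionSum u (full q)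
      ≡⟨ ≡.cong (λ z → (N * z) * partitionSum u (full q)) (≡.sym factorials≡) ⟩
    (N * factorials u (full q)) * partitionSum u (full q)
      ≡⟨ ℚ.*-assoc N (factorials u (full q)) (partitionSum u (full q)) ⟩
    N * (factorials u (full q) * partitionSum u (full q))
      ≡⟨ ≡.cong (N *_) (ℚ.*-comm (factorials u (full q)) (partitionSum u (full q))) ⟩
    N * (partitionSum u (full q) * factorials u (full q))
      ≡⟨ ≡.cong (N *_) (partitionSum*factorials u (full q)) ⟩
    N * 1ℚ ≡⟨ ℚ.*-identityʳ N ⟩
    N ∎
    where
    open ≡.≡-Reasoning
    N : ℚ
    N = fromℕ (length (withMultiplicities q (multiplicities u)))
    factorials≡ : factorials u (full q) ≡ factorialProduct (multiplicities u)
    factorials≡ = ∏-cong-∈ (allFin n) (λ a _ → ≡.cong (λ c → fromℕ (c ℕ.!)) (≡.sym (lookup-multiplicities u a)))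

module _ {c ℓ} (R : CommutativeRing c ℓ) (ι : ℚ → CommutativeRing.Carrier R)
         (ι-hom : IsRingHomomorphism ℚ-rawRing (CommutativeRing.rawRing R) ι) where
  open CommutativeRing R
  open IsRingHomomorphism ι-hom
  open import Relation.Binary.Reasoning.Setoid setoid

  ι-sum : ∀ {a} {A : Set a} (xs : List A) (f : A → ℚ) → ι (∑ ℚ-ring xs f) ≈ ∑ R xs (ι ∘ f)
  ι-sum []       f = 0#-homo
  ι-sum (x ∷ xs) f = trans (+-homo _ _) (+-congˡ (ι-sum xs f))

  sum-const : ∀ {a} {A : Set a} (xs : List A) (k : Carrier) → ∑ R xs (λ _ → k) ≈ k * ι (fromℕ (length xs))
  sum-const []       k = sym (trans (*-congˡ 0#-homo) (zeroʳ k))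
  sum-const (x ∷ xs) k = begin
    k + ∑ R xs (λ _ → k)                      ≈⟨ +-congˡ (sum-const xs k) ⟩
    k + k * ι (fromℕ (length xs))             ≈⟨ +-congʳ (sym (*-identityʳ k)) ⟩
    k * 1# + k * ι (fromℕ (length xs))        ≈⟨ sym (distribˡ k _ _) ⟩
    k * (1# + ι (fromℕ (length xs)))          ≈⟨ *-congˡ (+-congʳ (sym 1#-homo)) ⟩
    k * (ι 1ℚ + ι (fromℕ (length xs)))        ≈⟨ *-congˡ (sym (+-homo _ _)) ⟩
    k * ι (1ℚ ℚ.+ fromℕ (length xs))          ≈⟨ *-congˡ (reflexive (≡.cong ι (≡.sym (fromℕ-suc (length xs))))) ⟩
    k * ι (fromℕ (ℕ.suc (length xs)))         ∎

  module AbelianSquareSum (q n : ℕ) (h : Vec (Fin n) (q ℕ.+ q) → Carrier)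
           (h-cong : ∀ t t′ → (∀ k → fstHalf q t k ≡ fstHalf q t′ k) → h t ≈ h t′)
           (A : List (Vec (Fin n) (q ℕ.+ q))) (unique-A : Unique A) (A⇔ : ∀ t → (t ∈ A) ⇔ IsAbelianSquare q t) where

    private
      V = allVecs (allFin n) q
      rearrangements : Vec (Fin n) q → List (Vec (Fin n) q)
      rearrangements u = withMultiplicities q (multiplicities u)

    sum-by-first-half : ∑ R A h ≈ ∑ R V (λ u → ∑ R (filter (λ t → firstHalf q t ≟ᵥ u) A) h)
    sum-by-first-half = sym (begin
      ∑ R V (λ u → ∑ R (filter (λ t → firstHalf q t ≟ᵥ u) A) h)
        ≈⟨ sum-cong R V (λ u → sum-filter R (λ t → firstHalf q t ≟ᵥ u) A h) ⟩
      ∑ R V (λ u → ∑ R A (λ t → if does (firstHalf q t ≟ᵥ u) then h t else 0#))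
        ≈⟨ sum-swap R V A _ ⟩
      ∑ R A (λ t → ∑ R V (δ R _≟ᵥ_ (firstHalf q t) (h t)))
        ≈⟨ sum-cong R A (λ t → sum-δ R _≟ᵥ_ V (h t) (allVecs-unique (allFin n) q (Unique.allFin⁺ n))
                                                 (allVecs-complete (allFin n) q ∈-allFin (firstHalf q t))) ⟩
      ∑ R A h ∎)

    sum-over-first-half : ∀ u → ∑ R (filter (λ t → firstHalf q t ≟ᵥ u) A) h ≈ h (double u) * ι (fromℕ (length (rearrangements u)))
    sum-over-first-half u = begin
      ∑ R (filter (λ t → firstHalf q t ≟ᵥ u) A) h ≈⟨ sum-↭ R h (withFirstHalf↭rearrangements A unique-A A⇔ u) ⟩
      ∑ R (map (u ++_) (rearrangements u)) h      ≈⟨ sum-map R (rearrangements u) (u ++_) h ⟩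
      ∑ R (rearrangements u) (λ v → h (u ++ v))   ≈⟨ sum-cong R (rearrangements u) (λ v → h-cong _ _ (first-halves v)) ⟩
      ∑ R (rearrangements u) (λ _ → h (double u)) ≈⟨ sum-const (rearrangements u) _ ⟩
      h (double u) * ι (fromℕ (length (rearrangements u))) ∎
      where
      first-halves : ∀ v k → fstHalf q (u ++ v) k ≡ fstHalf q (double u) k
      first-halves v k = ≡.trans (Vec.lookup-++ˡ u v k) (≡.sym (Vec.lookup-++ˡ u u k))

    partition-side : ∑ R (SetPartitions q) (λ π → ∑ R (filter (_≺? π) V) λ u → h (double u) * ι (weight π))
                     ≈ ∑ R V (λ u → h (double u) * ι (fromℕ (length (rearrangements u))))
    partition-side = begin
      ∑ R Π (λ π → ∑ R (filter (_≺? π) V) λ u → h (double u) * ι (weight π))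
        ≈⟨ sum-cong R Π (λ π → sum-filter R (_≺? π) V _) ⟩
      ∑ R Π (λ π → ∑ R V λ u → if does (u ≺? π) then h (double u) * ι (weight π) else 0#)
        ≈⟨ sum-swap R Π V _ ⟩
      ∑ R V (λ u → ∑ R Π λ π → if does (u ≺? π) then h (double u) * ι (weight π) else 0#)
        ≈⟨ sum-cong R V (λ u → sym (sum-filter R (u ≺?_) Π _)) ⟩
      ∑ R V (λ u → ∑ R (filter (u ≺?_) Π) λ π → h (double u) * ι (weight π))
        ≈⟨ sum-cong R V (λ u → sym (sum-*ˡ R (filter (u ≺?_) Π) (h (double u)) (ι ∘ weight))) ⟩
      ∑ R V (λ u → h (double u) * ∑ R (filter (u ≺?_) Π) (ι ∘ weight))
        ≈⟨ sum-cong R V (λ u → *-congˡ (sym (ι-sum (filter (u ≺?_) Π) weight))) ⟩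
      ∑ R V (λ u → h (double u) * ι (∑ ℚ-ring (filter (u ≺?_) Π) weight))
        ≈⟨ sum-cong R V (λ u → *-congˡ (reflexive (≡.cong ι (weight-sum≡#rearrangements u)))) ⟩
      ∑ R V (λ u → h (double u) * ι (fromℕ (length (rearrangements u)))) ∎
      where
      Π : List (Relation q)
      Π = SetPartitions q

open import Defs
open import Level using (Level)
open import Data.Nat using (ℕ; _<_; _+_)
open import Data.Fin using (Fin)
open import Data.Vec using (Vec)
open import Data.List using (List; allFin; filter)
open import Data.List.Membership.Propositional using (_∈_)
open import Data.List.Relation.Unary.Unique.Propositional using (Unique)
open import Data.Rational using (ℚ) renaming (+-*-rawRing to ℚ-rawRing)
open import Data.Product using (_×_)
open import Relation.Binary.PropositionalEquality using (_≡_)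
open import Function.Bundles using (_⇔_)
open import Algebra.Bundles using (CommutativeRing)
open import Algebra.Morphism.Structures using (IsRingHomomorphism)

lemma5p2 : ∀ {c ℓ} (R : CommutativeRing c ℓ)
           (ι : ℚ → CommutativeRing.Carrier R)
           → IsRingHomomorphism ℚ-rawRing (CommutativeRing.rawRing R) ι
           → (q n : ℕ) → 0 < q → 0 < n
           → (h : Vec (Fin n) (q + q) → CommutativeRing.Carrier R)
           → (∀ t t′ → (∀ k → fstHalf q t k ≡ fstHalf q t′ k)
                → CommutativeRing._≈_ R (h t) (h t′))
           → (A : List (Vec (Fin n) (q + q)))
           → Unique A
           → (∀ t → (t ∈ A) ⇔ IsAbelianSquare q t)
           → CommutativeRing._≈_ R
               (sumR R A h)
               (sumR R (SetPartitions q) λ π →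
                  sumR R (filter (_≺? π) (allVecs (allFin n) q)) λ u →
                    CommutativeRing._*_ R (h (double u)) (ι (weight π)))
lemma5p2 R ι ι-hom q n _ _ h h-cong A unique-A A⇔ =
  trans sum-by-first-half (trans (sum-cong R (allVecs (allFin n) q) sum-over-first-half) (sym partition-side))
  where
  open CommutativeRing R using (trans; sym)
  open AbelianSquareSum R ι ι-hom q n h h-cong A unique-A A⇔
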